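{- For $n\ge1$, $$\sum_{\pi\in\mathrm{PPF}(n)}x^{\mathrm{unl}(\pi)}y^{\mathrm{rep}(\pi)}=\prod_{i=1}^{n-1}\big(xy+(i-1)x+n-1-i\big).$$
   Context: A parking function of length $n$ is a sequence $\pi=(\pi_1,\dots,\pi_n)$ of positive integers whose increasing rearrangement $b_1\le\dots\le b_n$ satisfies $b_i\le i$. It is prime if for every $1\le j\le n-1$ at least $j+1$ of the entries are $\le j$; $\mathrm{PPF}(n)$ is the set of prime parking functions of length $n$. Under the classical protocol (cars $1,\dots,n$ arrive in order, car $i$ parks in the first unoccupied spot among $\pi_i,\pi_i+1,\dots,n$), $\mathrm{unl}(\pi)$ is the number of cars not parking at their preferred spot. $\mathrm{rep}(\pi)=\#\{2\le i\le n:\pi_i=\pi_{i-1}\}$. -}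

module Defs where

open import Level using (Level)
open import Data.Bool using (Bool; true; false; _∧_; not; if_then_else_)
open import Data.Nat using (ℕ; zero; suc; _+_; _∸_; _≤ᵇ_; _≡ᵇ_)
open import Data.Nat.Properties using (≤-decTotalOrder)
open import Data.List using (List; []; _∷_; length; map; filter; foldr; concatMap; applyUpTo)
open import Data.Bool.ListAction using (and; any)
open import Data.Maybe using (Maybe; just; nothing)
open import Relation.Nullary.Decidable using (does)
open import Relation.Binary.PropositionalEquality using (_≡_)
open import Algebra.Bundles using (CommutativeSemiring)
import Data.List.Sort.InsertionSort.Base as ISort

seqs : ℕ → ℕ → List (List ℕ)
seqs n zero = [] ∷ []
seqs n (suc k) = concatMap (λ a → map (a ∷_) (seqs n k)) (applyUpTo suc n)

sortℕ : List ℕ → List ℕ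
sortℕ = ISort.sort ≤-decTotalOrder

allLeIndex : ℕ → List ℕ → Bool
allLeIndex i [] = true
allLeIndex i (b ∷ bs) = (b ≤ᵇ i) ∧ allLeIndex (suc i) bs

allPositive : List ℕ → Bool
allPositive xs = and (map (λ a → 1 ≤ᵇ a) xs)

isParkingFunction : List ℕ → Bool
isParkingFunction π = allPositive π ∧ allLeIndex 1 (sortℕ π)

countLe : ℕ → List ℕ → ℕ
countLe j π = length (filter (λ a → Data.Nat._≤?_ a j) π)

isPrime : List ℕ → Bool
isPrime π = and (map (λ j → suc j ≤ᵇ countLe j π) (applyUpTo suc (length π ∸ 1)))

isPPF : List ℕ → Bool
isPPF π = isParkingFunction π ∧ isPrime π

PPF : ℕ → List (List ℕ)
PPF n = filter (λ π → isPPF π Data.Bool.≟ true) (seqs n n)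

occupied : ℕ → List ℕ → Bool
occupied s occ = any (λ t → t ≡ᵇ s) occ

firstFree : ℕ → ℕ → List ℕ → ℕ → Maybe ℕ
firstFree n zero occ s = nothing
firstFree n (suc fuel) occ s =
  if s ≤ᵇ n
  then (if occupied s occ then firstFree n fuel occ (suc s) else just s)
  else nothing

sameSpot : Maybe ℕ → ℕ → Bool
sameSpot (just s) p = s ≡ᵇ p
sameSpot nothing p = false

occAdd : Maybe ℕ → List ℕ → List ℕ
occAdd (just s) occ = s ∷ occ
occAdd nothing occ = occ

unlAux : ℕ → List ℕ → List ℕ → ℕ
unlAux n occ [] = 0
unlAux n occ (p ∷ ps) =
  (if sameSpot (firstFree n (suc n) occ p) p then 0 else 1)
  + unlAux n (occAdd (firstFree n (suc n) occ p) occ) ps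

unl : List ℕ → ℕ
unl π = unlAux (length π) [] π

rep : List ℕ → ℕ
rep [] = 0
rep (a ∷ []) = 0
rep (a ∷ b ∷ xs) = (if a ≡ᵇ b then 1 else 0) + rep (b ∷ xs)

module _ {c ℓ : Level} (R : CommutativeSemiring c ℓ) where
  open CommutativeSemiring R using (Carrier; rawSemiring; 0#; 1#) renaming (_+_ to _⊕_; _*_ to _⊛_)
  open import Algebra.Definitions.RawSemiring rawSemiring using (_^_; _×_)

  ppfPoly : ℕ → Carrier → Carrier → Carrier
  ppfPoly n x y = foldr (λ π acc → ((x ^ unl π) ⊛ (y ^ rep π)) ⊕ acc) 0# (PPF n)

  rhsPoly : ℕ → Carrier → Carrier → Carrier
  rhsPoly n x y = foldr (λ i acc → ((x ⊛ y) ⊕ ((i ∸ 1) × x) ⊕ ((n ∸ 1 ∸ i) × 1#)) ⊛ acc) 1#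
                        (applyUpTo suc (n ∸ 1))

-- Write m = n − 1. A prime parking function has its entries in [1, m], so the sum runs over the
-- prime sequences in [1, m]^n. Each sequence in [1, m]^n is, in exactly one way, the rotation by r
-- (on the circle 1, …, m) of a sequence starting with m, and among the m rotations of a sequence
-- exactly one is prime (cycle lemma: the prime condition bounds j ↦ #{i : π_i ≤ j} from below, and
-- the right rotation is read off the last minimiser of #{i : π_i ≤ j} − j). On a prime sequence
-- parking on n spots agrees with parking on a circle of m spots, as only the last car can reach
-- spot n, and circular parking and rep are invariant under rotation. So the sum becomes the sum of
-- x^unl y^rep for circular parking over all sequences starting with m, which factorises car by car:
-- when k spots are taken, a new car contributes xy at the previous car's preference, x at each of
-- the other k − 1 taken spots and 1 at each of the m − k free ones.

module Submission where

open import Defs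
open import Level using (Level)
open import Algebra.Bundles using (CommutativeSemiring)
open import Data.Nat using (ℕ; zero; suc; _+_; _∸_; _≤_; _<_; _≥_; z≤n; s≤s; _≤ᵇ_; _≡ᵇ_; pred)
open import Data.Nat.Properties
open import Data.Nat.DivMod using (_%_; m%n<n; %-distribˡ-+; m%n%n≡m%n; m<n⇒m%n≡m; [m+n]%n≡m%n)
open import Data.Nat.Solver using (module +-*-Solver)
open import Data.Bool using (Bool; true; false; T; _∧_; _∨_; not; if_then_else_)
import Data.Bool
open import Data.Bool.Properties using (T-≡; ∧-zeroʳ; ∧-identityʳ; ∨-zeroʳ; not-¬)
open import Data.Maybe using (just; nothing)
open import Data.Maybe.Properties using (just-injective)
open import Data.List using (List; []; _∷_; length; map; filter; foldr; applyUpTo; _++_; concatMap)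
open import Data.List.Properties using (length-map; length-filter; filter-complete; filter-none)
open import Data.List.Relation.Unary.All as All using (All; []; _∷_; universal; zipWith)
open import Data.List.Relation.Unary.All.Properties using (all⁺; all⁻; applyUpTo⁺₁; applyUpTo⁻; all-filter; map⁺)
open import Data.List.Relation.Unary.Linked as Linked using (Linked)
open import Data.List.Relation.Unary.Linked.Properties using (Linked⇒All)
open import Data.List.Relation.Binary.Permutation.Propositional using (_↭_)
open import Data.List.Relation.Binary.Permutation.Propositional.Properties using (↭-length; filter-↭)
import Data.List.Sort.InsertionSort.Properties as InsertionSort
open import Data.Product using (Σ; _×_; _,_; proj₁; proj₂)
open import Data.Sum using (_⊎_; inj₁; inj₂)
open import Data.Empty using (⊥; ⊥-elim)
open import Function using (_∘_)
open import Function.Bundles using (_⇔_; mk⇔; Equivalence)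
open import Relation.Nullary using (¬_; yes; no)
open import Relation.Nullary.Decidable using (dec-true; dec-false)
open import Relation.Binary.Definitions using (tri<; tri≈; tri>)
open import Relation.Binary.PropositionalEquality
open import Algebra.Properties.CommutativeSemigroup +-commutativeSemigroup using () renaming (interchange to +-interchange)

open Equivalence using (to; from)
open +-*-Solver using (solve; _:+_; _:=_; con)

𝟙 : Bool → ℕ
𝟙 b = if b then 1 else 0

𝟙-≤ᵇ-yes : ∀ {a j} → a ≤ j → 𝟙 (a ≤ᵇ j) ≡ 1
𝟙-≤ᵇ-yes {a} {j} a≤j = cong 𝟙 (dec-true (a ≤? j) a≤j)

𝟙-≤ᵇ-no : ∀ {a j} → j < a → 𝟙 (a ≤ᵇ j) ≡ 0
𝟙-≤ᵇ-no {a} {j} j<a = cong 𝟙 (dec-false (a ≤? j) (<⇒≱ j<a))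

≤ᵇ-cancelˡ : ∀ c a b → (c + a ≤ᵇ c + b) ≡ (a ≤ᵇ b)
≤ᵇ-cancelˡ zero a b = refl
≤ᵇ-cancelˡ (suc c) a b = trans (≤ᵇ-suc (c + a)) (≤ᵇ-cancelˡ c a b)
  where
    ≤ᵇ-suc : ∀ a {b} → (suc a ≤ᵇ suc b) ≡ (a ≤ᵇ b)
    ≤ᵇ-suc zero = refl
    ≤ᵇ-suc (suc a) = refl

≡ᵇ-true⇒≡ : ∀ a b → (a ≡ᵇ b) ≡ true → a ≡ b
≡ᵇ-true⇒≡ a b e = ≡ᵇ⇒≡ a b (subst T (sym e) _)

≤-offset⇔ : ∀ {a b c d e f X Y} → a + e ≡ X → b + e ≡ Y → c + f ≡ X → d + f ≡ Y → a ≤ b ⇔ c ≤ d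
≤-offset⇔ {a} {b} {c} {d} {e} {f} a+e b+e c+f d+f = mk⇔
  (λ a≤b → +-cancelʳ-≤ f c d (subst₂ _≤_ (trans a+e (sym c+f)) (trans b+e (sym d+f)) (+-monoˡ-≤ e a≤b)))
  (λ c≤d → +-cancelʳ-≤ e a b (subst₂ _≤_ (trans c+f (sym a+e)) (trans d+f (sym b+e)) (+-monoˡ-≤ f c≤d)))

InRange : ℕ → ℕ → Set
InRange M v = 1 ≤ v × v ≤ M

countLe-∷ : ∀ j a π → countLe j (a ∷ π) ≡ 𝟙 (a ≤ᵇ j) + countLe j π
countLe-∷ j a π with a ≤ᵇ j
... | true = refl
... | false = refl

countLe-top : ∀ M π → All (InRange M) π → countLe M π ≡ length π
countLe-top M [] [] = refl
countLe-top M (v ∷ π) (iv ∷ ivs) = trans (countLe-∷ M v π) (cong₂ _+_ (𝟙-≤ᵇ-yes (proj₂ iv)) (countLe-top M π ivs))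

countLe-zero : ∀ M π → All (InRange M) π → countLe 0 π ≡ 0
countLe-zero M [] [] = refl
countLe-zero M (v ∷ π) (iv ∷ ivs) = trans (countLe-∷ 0 v π) (cong₂ _+_ (𝟙-≤ᵇ-no (proj₁ iv)) (countLe-zero M π ivs))

countLe-map-pointwise : ∀ {P : ℕ → Set} (f : ℕ → ℕ) j k J J′ π → All P π →
  (∀ v → P v → 𝟙 (f v ≤ᵇ j) + 𝟙 (v ≤ᵇ k) ≡ 𝟙 (v ≤ᵇ J) + 𝟙 (v ≤ᵇ J′)) →
  countLe j (map f π) + countLe k π ≡ countLe J π + countLe J′ π
countLe-map-pointwise f j k J J′ [] [] _ = refl
countLe-map-pointwise f j k J J′ (v ∷ π) (iv ∷ ivs) pointwise = begin
  countLe j (f v ∷ map f π) + countLe k (v ∷ π)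
    ≡⟨ cong₂ _+_ (countLe-∷ j (f v) (map f π)) (countLe-∷ k v π) ⟩
  (𝟙 (f v ≤ᵇ j) + countLe j (map f π)) + (𝟙 (v ≤ᵇ k) + countLe k π)
    ≡⟨ +-interchange (𝟙 (f v ≤ᵇ j)) _ (𝟙 (v ≤ᵇ k)) _ ⟩
  (𝟙 (f v ≤ᵇ j) + 𝟙 (v ≤ᵇ k)) + (countLe j (map f π) + countLe k π)
    ≡⟨ cong₂ _+_ (pointwise v iv) (countLe-map-pointwise f j k J J′ π ivs pointwise) ⟩
  (𝟙 (v ≤ᵇ J) + 𝟙 (v ≤ᵇ J′)) + (countLe J π + countLe J′ π)
    ≡⟨ +-interchange (𝟙 (v ≤ᵇ J)) _ (countLe J π) _ ⟩
  (𝟙 (v ≤ᵇ J) + countLe J π) + (𝟙 (v ≤ᵇ J′) + countLe J′ π)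
    ≡⟨ cong₂ _+_ (countLe-∷ J v π) (countLe-∷ J′ v π) ⟨
  countLe J (v ∷ π) + countLe J′ (v ∷ π) ∎
  where open ≡-Reasoning

countLe-↭ : ∀ j {xs ys} → xs ↭ ys → countLe j xs ≡ countLe j ys
countLe-↭ j xs↭ys = ↭-length (filter-↭ (_≤? j) xs↭ys)

countLe≡length⇒All : ∀ j π → countLe j π ≡ length π → All (_≤ j) π
countLe≡length⇒All j π e = subst (All (_≤ j)) (filter-complete (_≤? j) e) (all-filter (_≤? j) π)

countLe-sorted-below : ∀ {i c bs} → Linked _≤_ (c ∷ bs) → i < c → countLe i (c ∷ bs) ≡ 0
countLe-sorted-below l i<c = cong length (filter-none (_≤? _) (All.map <⇒≱ (Linked⇒All ≤-trans i<c l)))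

module Rotation (m₀ : ℕ) where

  m : ℕ
  m = suc m₀

  rotate : ℕ → ℕ → ℕ
  rotate r v = suc ((pred v + r) % m)

  rotate-inRange : ∀ r v → InRange m (rotate r v)
  rotate-inRange r v = s≤s z≤n , m%n<n (pred v + r) m

  %-absorbˡ : ∀ a b → (a % m + b) % m ≡ (a + b) % m
  %-absorbˡ a b = begin
    (a % m + b) % m          ≡⟨ %-distribˡ-+ (a % m) b m ⟩
    (a % m % m + b % m) % m  ≡⟨ cong (λ z → (z + b % m) % m) (m%n%n≡m%n a m) ⟩
    (a % m + b % m) % m      ≡⟨ %-distribˡ-+ a b m ⟨
    (a + b) % m              ∎
    where open ≡-Reasoning

  rotate-comm : ∀ d r v → InRange m v → rotate d (rotate r v) ≡ rotate r (rotate d v)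
  rotate-comm d r (suc v) _ = cong suc (begin
    ((v + r) % m + d) % m  ≡⟨ %-absorbˡ (v + r) d ⟩
    (v + r + d) % m        ≡⟨ cong (_% m) (+-assoc v r d) ⟩
    (v + (r + d)) % m      ≡⟨ cong (λ z → (v + z) % m) (+-comm r d) ⟩
    (v + (d + r)) % m      ≡⟨ cong (_% m) (+-assoc v d r) ⟨
    (v + d + r) % m        ≡⟨ %-absorbˡ (v + d) r ⟨
    ((v + d) % m + r) % m  ∎)
    where open ≡-Reasoning

  rotate-noWrap : ∀ r v → InRange m v → v + r ≤ m → rotate r v ≡ v + r
  rotate-noWrap r (suc v) _ le = cong suc (m<n⇒m%n≡m le)

  rotate-wrap : ∀ r v → InRange m v → r ≤ m → m < v + r → rotate r v + m ≡ v + r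
  rotate-wrap r (suc v) (_ , v<m) r≤m m<v+r = cong suc (begin
    (v + r) % m + m  ≡⟨ cong (λ z → z % m + m) v+r≡w+m ⟩
    (w + m) % m + m  ≡⟨ cong (_+ m) ([m+n]%n≡m%n w m) ⟩
    w % m + m        ≡⟨ cong (_+ m) (m<n⇒m%n≡m w<m) ⟩
    w + m            ≡⟨ v+r≡w+m ⟨
    v + r            ∎)
    where
      open ≡-Reasoning
      w = v + r ∸ m
      v+r≡w+m : v + r ≡ w + m
      v+r≡w+m = sym (m∸n+n≡m (≤-pred m<v+r))
      w<m : w < m
      w<m = +-cancelʳ-< m w m (subst (_< m + m) v+r≡w+m (+-mono-<-≤ v<m r≤m))

  rotate-zero : ∀ v → InRange m v → rotate 0 v ≡ v
  rotate-zero v iv = trans (rotate-noWrap 0 v iv (subst (_≤ m) (sym (+-identityʳ v)) (proj₂ iv))) (+-identityʳ v)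

  rotate-cases : ∀ r v → InRange m v → r ≤ m →
    (v + r ≤ m × rotate r v ≡ v + r) ⊎ (m < v + r × rotate r v + m ≡ v + r)
  rotate-cases r v iv r≤m with v + r ≤? m
  ... | yes le = inj₁ (le , rotate-noWrap r v iv le)
  ... | no nle = inj₂ (≰⇒> nle , rotate-wrap r v iv r≤m (≰⇒> nle))

  wrapped-apart : ∀ {r a b} → InRange m a → InRange m b → a + r + m ≢ b + r
  wrapped-apart {r} {a} {b} (1≤a , _) (_ , b≤m) e = n≮n m (≤-trans (+-monoˡ-≤ m 1≤a) (≤-trans (≤-reflexive a+m≡b) b≤m))
    where
      a+m≡b : a + m ≡ b
      a+m≡b = +-cancelʳ-≡ r _ _ (trans (solve 3 (λ a m r → a :+ m :+ r := a :+ r :+ m) refl a m r) e)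

  rotate-injective : ∀ r a b → InRange m a → InRange m b → r ≤ m → rotate r a ≡ rotate r b → a ≡ b
  rotate-injective r a b ia ib r≤m eq with rotate-cases r a ia r≤m | rotate-cases r b ib r≤m
  ... | inj₁ (_ , ea) | inj₁ (_ , eb) = +-cancelʳ-≡ r a b (trans (sym ea) (trans eq eb))
  ... | inj₂ (_ , ea) | inj₂ (_ , eb) = +-cancelʳ-≡ r a b (trans (sym ea) (trans (cong (_+ m) eq) eb))
  ... | inj₁ (_ , ea) | inj₂ (_ , eb) = ⊥-elim (wrapped-apart ia ib (trans (cong (_+ m) (trans (sym ea) eq)) eb))
  ... | inj₂ (_ , ea) | inj₁ (_ , eb) = ⊥-elim (wrapped-apart ib ia (trans (cong (_+ m) (trans (sym eb) (sym eq))) ea))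

  rotate-top : ∀ r → InRange m r → rotate r m ≡ r
  rotate-top r (1≤r , r≤m) = +-cancelʳ-≡ m _ _ (trans (rotate-wrap r m (s≤s z≤n , ≤-refl) r≤m (m<m+n m 1≤r)) (+-comm m r))

  rotate-surjective : ∀ p v → InRange m p → InRange m v → Σ ℕ λ d → d < m × rotate d p ≡ v
  rotate-surjective p v (1≤p , p≤m) (1≤v , v≤m) with p ≤? v
  ... | yes p≤v = d , d<m , trans (rotate-noWrap d p (1≤p , p≤m) (≤-trans (≤-reflexive p+d≡v) v≤m)) p+d≡v
    where
      d = v ∸ p
      p+d≡v : p + d ≡ v
      p+d≡v = m+[n∸m]≡n p≤v
      d<m : d < m
      d<m = <-≤-trans (+-cancelˡ-< p d v (subst (_< p + v) (sym p+d≡v) (m<n+m v 1≤p))) v≤m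
  ... | no p≰v = d , d<m , +-cancelʳ-≡ m _ _ (trans (rotate-wrap d p (1≤p , p≤m) (<⇒≤ d<m) m<p+d) p+d≡v+m)
    where
      d = v + m ∸ p
      p+d≡v+m : p + d ≡ v + m
      p+d≡v+m = m+[n∸m]≡n (≤-trans p≤m (m≤n+m m v))
      d<m : d < m
      d<m = +-cancelˡ-< p d m (subst (_< p + m) (sym p+d≡v+m) (+-monoˡ-< m (≰⇒> p≰v)))
      m<p+d : m < p + d
      m<p+d = subst (m <_) (sym p+d≡v+m) (m<n+m m 1≤v)

  module _ {k r : ℕ} (k+r≡m : k + r ≡ m) where

    rotate-low : ∀ v → InRange m v → v ≤ k → rotate r v ≡ r + v
    rotate-low v iv v≤k = trans (rotate-noWrap r v iv (subst (v + r ≤_) k+r≡m (+-monoˡ-≤ r v≤k))) (+-comm v r)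

    rotate-high : ∀ v → InRange m v → k < v → k + rotate r v ≡ v
    rotate-high v iv k<v = +-cancelʳ-≡ r _ _ (begin
      k + rotate r v + r  ≡⟨ solve 3 (λ k w r → k :+ w :+ r := w :+ (k :+ r)) refl k (rotate r v) r ⟩
      rotate r v + (k + r) ≡⟨ cong (rotate r v +_) k+r≡m ⟩
      rotate r v + m       ≡⟨ rotate-wrap r v iv r≤m (subst (_< v + r) k+r≡m (+-monoˡ-< r k<v)) ⟩
      v + r                ∎)
      where
        open ≡-Reasoning
        r≤m : r ≤ m
        r≤m = subst (r ≤_) k+r≡m (m≤n+m r k)

-- The cycle lemma

IsLastArgmin : (ℕ → ℕ) → ℕ → ℕ → Set
IsLastArgmin t M k = k < M × (∀ i → i < k → t k ≤ t i) × (∀ i → k < i → i < M → t k < t i)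

lastArgmin : ∀ (t : ℕ → ℕ) M → 0 < M → Σ ℕ (IsLastArgmin t M)
lastArgmin t (suc zero) _ = 0 , s≤s z≤n , (λ i ()) , λ i 0<i i<1 → ⊥-elim (n≮n 1 (≤-trans (s≤s 0<i) i<1))
lastArgmin t (suc (suc M)) _ with lastArgmin t (suc M) (s≤s z≤n)
... | k , k<M , before , after with t (suc M) ≤? t k
...   | yes tM≤tk = suc M , ≤-refl , before′ , λ i M<i i<M → ⊥-elim (n≮n _ (≤-trans (s≤s M<i) i<M))
  where
    before′ : ∀ i → i < suc M → t (suc M) ≤ t i
    before′ i i<M with <-cmp i k
    ... | tri< i<k _ _ = ≤-trans tM≤tk (before i i<k)
    ... | tri≈ _ refl _ = tM≤tk
    ... | tri> _ _ k<i = ≤-trans tM≤tk (<⇒≤ (after i k<i i<M))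
...   | no tM≰tk = k , m≤n⇒m≤1+n k<M , before , after′
  where
    after′ : ∀ i → k < i → i < suc (suc M) → t k < t i
    after′ i k<i i<M with m≤n⇒m<n∨m≡n (≤-pred i<M)
    ... | inj₁ i<M′ = after i k<i i<M′
    ... | inj₂ refl = ≰⇒> tM≰tk

module CycleLemma (m₀ : ℕ) where
  open Rotation m₀

  PrimeCondition : List ℕ → Set
  PrimeCondition ρ = ∀ j → 1 ≤ j → j < m → suc j ≤ countLe j ρ

  -- k is the last minimiser of i ↦ countLe i τ − i on [0, m)
  IsLastMin : List ℕ → ℕ → Set
  IsLastMin τ k = k < m × (∀ i → i < k → countLe k τ + i ≤ countLe i τ + k)
                        × (∀ i → k < i → i < m → countLe k τ + i < countLe i τ + k)

  lastMin-unique : ∀ τ {k₁ k₂} → IsLastMin τ k₁ → IsLastMin τ k₂ → k₁ ≡ k₂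
  lastMin-unique τ {k₁} {k₂} (k₁<m , before₁ , after₁) (k₂<m , before₂ , after₂) with <-cmp k₁ k₂
  ... | tri≈ _ e _ = e
  ... | tri< lt _ _ = ⊥-elim (<⇒≱ (after₁ k₂ lt k₂<m) (before₂ k₁ lt))
  ... | tri> _ _ gt = ⊥-elim (<⇒≱ (after₂ k₁ gt k₁<m) (before₁ k₂ gt))

  lastMin-exists : ∀ τ → Σ ℕ (IsLastMin τ)
  lastMin-exists τ with lastArgmin (λ i → countLe i τ + (m ∸ i)) m (s≤s z≤n)
  ... | k , k<m , before , after = k , k<m ,
        (λ i i<k → to (exchange i k (<⇒≤ (<-trans i<k k<m)) (<⇒≤ k<m)) (before i i<k)) ,
        (λ i k<i i<m → to (exchange i k (<⇒≤ i<m) (<⇒≤ k<m)) (after i k<i i<m))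
    where
      c : ℕ → ℕ
      c i = countLe i τ
      exchange : ∀ {a} i k → i ≤ m → k ≤ m → a + c k + (m ∸ k) ≤ c i + (m ∸ i) ⇔ a + c k + i ≤ c i + k
      exchange {a} i k i≤m k≤m = ≤-offset⇔ {e = k + i} {f = m}
        (trans (solve 4 (λ a x k i → a :+ x :+ (k :+ i) := a :+ i :+ (x :+ k)) refl (a + c k) (m ∸ k) k i)
               (cong (a + c k + i +_) (m∸n+n≡m k≤m)))
        (trans (solve 4 (λ b y k i → b :+ y :+ (k :+ i) := b :+ k :+ (y :+ i)) refl (c i) (m ∸ i) k i)
               (cong (c i + k +_) (m∸n+n≡m i≤m)))
        refl refl

  module _ {k r : ℕ} (k+r≡m : k + r ≡ m) where

    rotate-below : ∀ j v → j < r → InRange m v →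
      𝟙 (rotate r v ≤ᵇ j) + 𝟙 (v ≤ᵇ k) ≡ 𝟙 (v ≤ᵇ k + j) + 𝟙 (v ≤ᵇ 0)
    rotate-below j v j<r iv with v ≤? k
    ... | yes v≤k = begin
      𝟙 (rotate r v ≤ᵇ j) + 𝟙 (v ≤ᵇ k)  ≡⟨ cong₂ _+_ (𝟙-≤ᵇ-no j<rv) (𝟙-≤ᵇ-yes v≤k) ⟩
      1                                  ≡⟨ cong₂ _+_ (𝟙-≤ᵇ-yes (≤-trans v≤k (m≤m+n k j))) (𝟙-≤ᵇ-no (proj₁ iv)) ⟨
      𝟙 (v ≤ᵇ k + j) + 𝟙 (v ≤ᵇ 0)       ∎
      where
        open ≡-Reasoning
        j<rv : j < rotate r v
        j<rv = subst (j <_) (sym (rotate-low k+r≡m v iv v≤k)) (≤-trans j<r (m≤m+n r v))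
    ... | no v≰k = begin
      𝟙 (rotate r v ≤ᵇ j) + 𝟙 (v ≤ᵇ k)      ≡⟨ cong₂ _+_ (cong 𝟙 (≤ᵇ-cancelˡ k _ j)) (sym (𝟙-≤ᵇ-no (≰⇒> v≰k))) ⟨
      𝟙 (k + rotate r v ≤ᵇ k + j) + 0
        ≡⟨ cong₂ _+_ (cong (λ w → 𝟙 (w ≤ᵇ k + j)) (rotate-high k+r≡m v iv (≰⇒> v≰k))) (sym (𝟙-≤ᵇ-no (proj₁ iv))) ⟩
      𝟙 (v ≤ᵇ k + j) + 𝟙 (v ≤ᵇ 0)           ∎
      where open ≡-Reasoning

    rotate-above : ∀ j v → r ≤ j → j ≤ m → InRange m v →
      𝟙 (rotate r v ≤ᵇ j) + 𝟙 (v ≤ᵇ k) ≡ 𝟙 (v ≤ᵇ j ∸ r) + 𝟙 (v ≤ᵇ m)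
    rotate-above j v r≤j j≤m iv with v ≤? k
    ... | yes v≤k = begin
      𝟙 (rotate r v ≤ᵇ j) + 𝟙 (v ≤ᵇ k)
        ≡⟨ cong₂ _+_ (cong (λ w → 𝟙 (w ≤ᵇ j)) (rotate-low k+r≡m v iv v≤k)) (𝟙-≤ᵇ-yes v≤k) ⟩
      𝟙 (r + v ≤ᵇ j) + 1                         ≡⟨ cong (λ i → 𝟙 (r + v ≤ᵇ i) + 1) (m+[n∸m]≡n r≤j) ⟨
      𝟙 (r + v ≤ᵇ r + (j ∸ r)) + 1               ≡⟨ cong₂ _+_ (cong 𝟙 (≤ᵇ-cancelˡ r v (j ∸ r))) (sym (𝟙-≤ᵇ-yes (proj₂ iv))) ⟩
      𝟙 (v ≤ᵇ j ∸ r) + 𝟙 (v ≤ᵇ m)               ∎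
      where open ≡-Reasoning
    ... | no v≰k = begin
      𝟙 (rotate r v ≤ᵇ j) + 𝟙 (v ≤ᵇ k)  ≡⟨ cong₂ _+_ (𝟙-≤ᵇ-yes rv≤j) (𝟙-≤ᵇ-no k<v) ⟩
      1                                  ≡⟨ cong₂ _+_ (𝟙-≤ᵇ-no (≤-<-trans j∸r≤k k<v)) (𝟙-≤ᵇ-yes (proj₂ iv)) ⟨
      𝟙 (v ≤ᵇ j ∸ r) + 𝟙 (v ≤ᵇ m)       ∎
      where
        open ≡-Reasoning
        k<v : k < v
        k<v = ≰⇒> v≰k
        rv≤j : rotate r v ≤ j
        rv≤j = ≤-trans (+-cancelˡ-≤ k _ _ (subst₂ _≤_ (sym (rotate-high k+r≡m v iv k<v)) (sym k+r≡m) (proj₂ iv))) r≤j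
        j∸r≤k : j ∸ r ≤ k
        j∸r≤k = subst (j ∸ r ≤_) (trans (cong (_∸ r) (sym k+r≡m)) (m+n∸n≡m k r)) (∸-monoˡ-≤ r j≤m)

  module Rotated (τ : List ℕ) (iv : All (InRange m) τ) (len : length τ ≡ suc m) {r : ℕ} (1≤r : 1 ≤ r) (r≤m : r ≤ m) where

    k : ℕ
    k = m ∸ r

    k+r≡m : k + r ≡ m
    k+r≡m = m∸n+n≡m r≤m

    k<m : k < m
    k<m = ∸-monoʳ-< 1≤r r≤m

    ρ : List ℕ
    ρ = map (rotate r) τ

    c : ℕ → ℕ
    c i = countLe i τ

    countLe-below : ∀ j → j < r → countLe j ρ + c k ≡ c (k + j)
    countLe-below j j<r = trans (countLe-map-pointwise (rotate r) j k (k + j) 0 τ iv (λ v → rotate-below k+r≡m j v j<r))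
                                (trans (cong (c (k + j) +_) (countLe-zero m τ iv)) (+-identityʳ _))

    countLe-above : ∀ j → r ≤ j → j ≤ m → countLe j ρ + c k ≡ c (j ∸ r) + suc m
    countLe-above j r≤j j≤m = trans (countLe-map-pointwise (rotate r) j k (j ∸ r) m τ iv (λ v → rotate-above k+r≡m j v r≤j j≤m))
                                    (cong (c (j ∸ r) +_) (trans (countLe-top m τ iv) len))

    prime-below⇔ : ∀ j → j < r → suc j ≤ countLe j ρ ⇔ c k + (k + j) < c (k + j) + k
    prime-below⇔ j j<r = ≤-offset⇔ {e = c k + k} {f = 0}
      (solve 3 (λ j ck k → con 1 :+ j :+ (ck :+ k) := con 1 :+ (ck :+ (k :+ j)) :+ con 0) refl j (c k) k)
      (begin
        countLe j ρ + (c k + k)  ≡⟨ +-assoc (countLe j ρ) (c k) k ⟨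
        countLe j ρ + c k + k    ≡⟨ cong (_+ k) (countLe-below j j<r) ⟩
        c (k + j) + k            ≡⟨ +-identityʳ _ ⟨
        c (k + j) + k + 0        ∎)
      refl refl
      where open ≡-Reasoning

    prime-above⇔ : ∀ j → r ≤ j → j ≤ m → suc j ≤ countLe j ρ ⇔ c k + (j ∸ r) ≤ c (j ∸ r) + k
    prime-above⇔ j r≤j j≤m = ≤-offset⇔ {e = c k} {f = suc r} refl (countLe-above j r≤j j≤m)
      (begin
        c k + i + suc r      ≡⟨ solve 3 (λ ck i r → ck :+ i :+ (con 1 :+ r) := con 1 :+ (i :+ r) :+ ck) refl (c k) i r ⟩
        suc (i + r) + c k    ≡⟨ cong (λ z → suc z + c k) (m∸n+n≡m r≤j) ⟩
        suc j + c k          ∎)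
      (begin
        c i + k + suc r      ≡⟨ solve 3 (λ ci k r → ci :+ k :+ (con 1 :+ r) := ci :+ (con 1 :+ (k :+ r))) refl (c i) k r ⟩
        c i + suc (k + r)    ≡⟨ cong (λ z → c i + suc z) k+r≡m ⟩
        c i + suc m          ∎)
      where
        open ≡-Reasoning
        i = j ∸ r

    prime⇒lastMin : PrimeCondition ρ → IsLastMin τ k
    prime⇒lastMin primeCond = k<m , before , after
      where
        before : ∀ i → i < k → c k + i ≤ c i + k
        before i i<k = subst (λ z → c k + z ≤ c z + k) (m+n∸n≡m i r)
          (to (prime-above⇔ (i + r) (m≤n+m r i) (<⇒≤ i+r<m)) (primeCond (i + r) (≤-trans 1≤r (m≤n+m r i)) i+r<m))
          where
            i+r<m : i + r < m
            i+r<m = subst (i + r <_) k+r≡m (+-monoˡ-< r i<k)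
        after : ∀ i → k < i → i < m → c k + i < c i + k
        after i k<i i<m = subst (λ z → c k + z < c z + k) (m+[n∸m]≡n (<⇒≤ k<i))
          (to (prime-below⇔ j j<r) (primeCond j (m<n⇒0<n∸m k<i) (<-≤-trans j<r r≤m)))
          where
            j = i ∸ k
            j<r : j < r
            j<r = +-cancelˡ-< k j r (subst₂ _<_ (sym (m+[n∸m]≡n (<⇒≤ k<i))) (sym k+r≡m) i<m)

    lastMin⇒prime : IsLastMin τ k → PrimeCondition ρ
    lastMin⇒prime (_ , before , after) j 1≤j j<m with j <? r
    ... | yes j<r = from (prime-below⇔ j j<r) (after (k + j) (m<m+n k 1≤j) (subst (k + j <_) k+r≡m (+-monoʳ-< k j<r)))
    ... | no j≮r = from (prime-above⇔ j r≤j (<⇒≤ j<m)) (before (j ∸ r) j∸r<k)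
      where
        r≤j : r ≤ j
        r≤j = ≮⇒≥ j≮r
        j∸r<k : j ∸ r < k
        j∸r<k = +-cancelʳ-< r _ _ (subst₂ _<_ (sym (m∸n+n≡m r≤j)) (sym k+r≡m) j<m)

  primeRotation-unique : ∀ τ → All (InRange m) τ → length τ ≡ suc m → ∀ {r₁ r₂} → InRange m r₁ → InRange m r₂ →
    PrimeCondition (map (rotate r₁) τ) → PrimeCondition (map (rotate r₂) τ) → r₁ ≡ r₂
  primeRotation-unique τ iv len (1≤r₁ , r₁≤m) (1≤r₂ , r₂≤m) primeCond₁ primeCond₂ = ∸-cancelˡ-≡ r₁≤m r₂≤m (lastMin-unique τ
    (Rotated.prime⇒lastMin τ iv len 1≤r₁ r₁≤m primeCond₁) (Rotated.prime⇒lastMin τ iv len 1≤r₂ r₂≤m primeCond₂))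

  primeRotation-exists : ∀ τ → All (InRange m) τ → length τ ≡ suc m → Σ ℕ λ r → InRange m r × PrimeCondition (map (rotate r) τ)
  primeRotation-exists τ iv len with lastMin-exists τ
  ... | k , lastMin@(k<m , _) = m ∸ k , (1≤r , r≤m) ,
        Rotated.lastMin⇒prime τ iv len 1≤r r≤m (subst (IsLastMin τ) (sym (m∸[m∸n]≡n (<⇒≤ k<m))) lastMin)
    where
      1≤r : 1 ≤ m ∸ k
      1≤r = m<n⇒0<n∸m k<m
      r≤m : m ∸ k ≤ m
      r≤m = m∸n≤m m k

-- Prime parking functions

allLeIndex-sorted : ∀ i bs → Linked _≤_ bs → (∀ j → i ≤ j → j < i + length bs → j < i + countLe j bs) →
  allLeIndex i bs ≡ true
allLeIndex-sorted i [] _ _ = refl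
allLeIndex-sorted i (c ∷ bs) l enough with c ≤? i
... | no c≰i = ⊥-elim (n≮n i (subst (i <_) i+countLe≡i (enough i ≤-refl (m<m+n i (s≤s z≤n)))))
  where
    i+countLe≡i : i + countLe i (c ∷ bs) ≡ i
    i+countLe≡i = trans (cong (i +_) (countLe-sorted-below l (≰⇒> c≰i))) (+-identityʳ i)
... | yes c≤i rewrite dec-true (c ≤? i) c≤i = allLeIndex-sorted (suc i) bs (Linked.tail l) enough′
  where
    enough′ : ∀ j → suc i ≤ j → j < suc i + length bs → j < suc i + countLe j bs
    enough′ j i<j j<len = subst (j <_) (trans (cong (i +_) (trans (countLe-∷ j c bs) (cong (_+ countLe j bs) (𝟙-≤ᵇ-yes c≤j)))) (+-suc i _))
                                (enough j (<⇒≤ i<j) (subst (j <_) (sym (+-suc i _)) j<len))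
      where
        c≤j : c ≤ j
        c≤j = ≤-trans c≤i (<⇒≤ i<j)

module Primality (m₀ : ℕ) where
  open Rotation m₀
  open CycleLemma m₀ using (PrimeCondition)

  n : ℕ
  n = suc m

  isPrime⇔ : ∀ π → length π ≡ n → isPrime π ≡ true ⇔ (∀ j → 1 ≤ j → j ≤ m → suc j ≤ countLe j π)
  isPrime⇔ π len = mk⇔
    (λ isP → λ { (suc i) _ i<m → ≤ᵇ⇒≤ _ _ (applyUpTo⁻ suc m (subst Thresholds len (all⁺ holds _ (from T-≡ isP))) i<m) })
    (λ h → to T-≡ (all⁻ holds (subst Thresholds (sym len) (applyUpTo⁺₁ suc m (λ i<m → ≤⇒≤ᵇ (h _ (s≤s z≤n) i<m))))))
    where
      holds : ℕ → Bool
      holds j = suc j ≤ᵇ countLe j π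
      Thresholds : ℕ → Set
      Thresholds L = All (λ j → T (holds j)) (applyUpTo suc (L ∸ 1))

  primeCondition⇔isPrime : ∀ π → All (InRange m) π → length π ≡ n → PrimeCondition π ⇔ isPrime π ≡ true
  primeCondition⇔isPrime π iv len = mk⇔
    (λ primeCond → from (isPrime⇔ π len) λ j 1≤j j≤m → case-top primeCond j 1≤j (m≤n⇒m<n∨m≡n j≤m))
    (λ isP j 1≤j j<m → to (isPrime⇔ π len) isP j 1≤j (<⇒≤ j<m))
    where
      case-top : PrimeCondition π → ∀ j → 1 ≤ j → j < m ⊎ j ≡ m → suc j ≤ countLe j π
      case-top primeCond j 1≤j (inj₁ j<m) = primeCond j 1≤j j<m
      case-top primeCond j 1≤j (inj₂ refl) = ≤-reflexive (sym (trans (countLe-top m π iv) len))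

  prime⇒≤m : ∀ π → length π ≡ n → isPrime π ≡ true → All (_≤ m) π
  prime⇒≤m π len isP = countLe≡length⇒All m π
    (≤-antisym (length-filter (_≤? m) π) (subst (_≤ countLe m π) (sym len) (to (isPrime⇔ π len) isP m (s≤s z≤n) ≤-refl)))

  prime⇒parking : ∀ π → All (InRange n) π → length π ≡ n → isPrime π ≡ true → isParkingFunction π ≡ true
  prime⇒parking π iv len isP = cong₂ _∧_ positive sorted
    where
      positive : allPositive π ≡ true
      positive = to T-≡ (all⁻ (1 ≤ᵇ_) (All.map (λ v → ≤⇒≤ᵇ (proj₁ v)) iv))
      sorted : allLeIndex 1 (sortℕ π) ≡ true
      sorted = allLeIndex-sorted 1 (sortℕ π) (InsertionSort.sort-↗ ≤-decTotalOrder π) enough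
        where
          sort↭π = InsertionSort.sort-↭ ≤-decTotalOrder π
          enough : ∀ j → 1 ≤ j → j < 1 + length (sortℕ π) → j < 1 + countLe j (sortℕ π)
          enough j 1≤j j≤len rewrite countLe-↭ j sort↭π with m≤n⇒m<n∨m≡n (≤-pred (subst (j <_) (cong suc (trans (↭-length sort↭π) len)) j≤len))
          ... | inj₁ j≤m = m≤n⇒m≤1+n (to (isPrime⇔ π len) isP j 1≤j (≤-pred j≤m))
          ... | inj₂ refl = s≤s (≤-reflexive (sym (trans (countLe-top n π iv) len)))

  isPPF≡isPrime : ∀ π → All (InRange n) π → length π ≡ n → isPPF π ≡ isPrime π
  isPPF≡isPrime π iv len with isPrime π in isP
  ... | true = cong (_∧ true) (prime⇒parking π iv len isP)
  ... | false = ∧-zeroʳ _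

-- Parking on a circle

Occupancy : Set
Occupancy = ℕ → Bool

vacant : Occupancy
vacant _ = false

count : (ℕ → Bool) → ℕ → ℕ
count h zero = 0
count h (suc N) = count h N + 𝟙 (h (suc N))

count-notFull : ∀ h N → count h N < N → Σ ℕ λ t → InRange N t × h t ≡ false
count-notFull h (suc N) lt with h (suc N) in e
... | false = suc N , (s≤s z≤n , ≤-refl) , e
... | true with count-notFull h N (≤-pred (subst (_< suc N) (+-comm (count h N) 1) lt))
...   | t , (1≤t , t≤N) , ht = t , (1≤t , m≤n⇒m≤1+n t≤N) , ht

count-pointwise : ∀ (f g h : ℕ → Bool) N → (∀ t → InRange N t → 𝟙 (f t) + 𝟙 (g t) ≡ 𝟙 (h t)) →
  count f N + count g N ≡ count h N
count-pointwise f g h zero _ = refl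
count-pointwise f g h (suc N) pointwise = begin
  (count f N + 𝟙 (f (suc N))) + (count g N + 𝟙 (g (suc N)))  ≡⟨ +-interchange (count f N) _ (count g N) _ ⟩
  (count f N + count g N) + (𝟙 (f (suc N)) + 𝟙 (g (suc N)))  ≡⟨ cong₂ _+_ below (pointwise (suc N) (s≤s z≤n , ≤-refl)) ⟩
  count h N + 𝟙 (h (suc N))                                  ∎
  where
    open ≡-Reasoning
    below = count-pointwise f g h N (λ t (1≤t , t≤N) → pointwise t (1≤t , m≤n⇒m≤1+n t≤N))

count-all : ∀ N → count (λ _ → true) N ≡ N
count-all zero = refl
count-all (suc N) = trans (cong (_+ 1) (count-all N)) (+-comm N 1)

count-none : ∀ N → count vacant N ≡ 0
count-none zero = refl
count-none (suc N) = trans (+-identityʳ _) (count-none N)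

count-single : ∀ p N → 1 ≤ p → count (p ≡ᵇ_) N ≡ 𝟙 (p ≤ᵇ N)
count-single p zero 1≤p = sym (𝟙-≤ᵇ-no 1≤p)
count-single p (suc N) 1≤p with p ≤? N
... | yes p≤N = begin
  count (p ≡ᵇ_) N + 𝟙 (p ≡ᵇ suc N)
    ≡⟨ cong₂ _+_ (trans (count-single p N 1≤p) (𝟙-≤ᵇ-yes p≤N)) (cong 𝟙 (dec-false (p ≟ suc N) (<⇒≢ (s≤s p≤N)))) ⟩
  1                                   ≡⟨ 𝟙-≤ᵇ-yes (m≤n⇒m≤1+n p≤N) ⟨
  𝟙 (p ≤ᵇ suc N)                      ∎
  where open ≡-Reasoning
... | no p≰N with p ≟ suc N
...   | yes refl = begin
  count (p ≡ᵇ_) N + 𝟙 (p ≡ᵇ p)  ≡⟨ cong₂ _+_ (trans (count-single p N 1≤p) (𝟙-≤ᵇ-no (≰⇒> p≰N))) (cong 𝟙 (dec-true (p ≟ p) refl)) ⟩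
  1                              ≡⟨ 𝟙-≤ᵇ-yes (≤-refl {p}) ⟨
  𝟙 (p ≤ᵇ p)                     ∎
  where open ≡-Reasoning
...   | no p≢1+N = begin
  count (p ≡ᵇ_) N + 𝟙 (p ≡ᵇ suc N)
    ≡⟨ cong₂ _+_ (trans (count-single p N 1≤p) (𝟙-≤ᵇ-no (≰⇒> p≰N))) (cong 𝟙 (dec-false (p ≟ suc N) p≢1+N)) ⟩
  0                                   ≡⟨ 𝟙-≤ᵇ-no (≤∧≢⇒< (≰⇒> p≰N) (p≢1+N ∘ sym)) ⟨
  𝟙 (p ≤ᵇ suc N)                      ∎
  where
    open ≡-Reasoning

count-occupiedAbove : ∀ (O : ℕ → Bool) j N → j ≤ N → (∀ t → j < t → t ≤ N → O t ≡ true) → count O N ≡ count O j + (N ∸ j)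
count-occupiedAbove O j zero z≤n _ = refl
count-occupiedAbove O j (suc N) j≤1+N full with m≤n⇒m<n∨m≡n j≤1+N
... | inj₂ refl = sym (trans (cong (count O (suc N) +_) (n∸n≡0 (suc N))) (+-identityʳ _))
... | inj₁ j≤N rewrite full (suc N) j≤N ≤-refl = begin
  count O N + 1              ≡⟨ cong (_+ 1) (count-occupiedAbove O j N (≤-pred j≤N) (λ t j<t t≤N → full t j<t (m≤n⇒m≤1+n t≤N))) ⟩
  count O j + (N ∸ j) + 1    ≡⟨ +-assoc (count O j) _ 1 ⟩
  count O j + (N ∸ j + 1)    ≡⟨ cong (count O j +_) (trans (+-comm _ 1) (sym (+-∸-assoc 1 (≤-pred j≤N)))) ⟩
  count O j + (suc N ∸ j)    ∎
  where open ≡-Reasoning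

occupy : Occupancy → ℕ → Occupancy
occupy O s t = (s ≡ᵇ t) ∨ O t

count-occupy : ∀ (O : Occupancy) s N → O s ≡ false → 1 ≤ s → count (occupy O s) N ≡ count O N + 𝟙 (s ≤ᵇ N)
count-occupy O s N free 1≤s = begin
  count (occupy O s) N              ≡⟨ count-pointwise (s ≡ᵇ_) O (occupy O s) N (λ t _ → disjoint t) ⟨
  count (s ≡ᵇ_) N + count O N       ≡⟨ +-comm _ (count O N) ⟩
  count O N + count (s ≡ᵇ_) N       ≡⟨ cong (count O N +_) (count-single s N 1≤s) ⟩
  count O N + 𝟙 (s ≤ᵇ N)            ∎
  where
    open ≡-Reasoning
    disjoint : ∀ t → 𝟙 (s ≡ᵇ t) + 𝟙 (O t) ≡ 𝟙 ((s ≡ᵇ t) ∨ O t)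
    disjoint t with s ≡ᵇ t in e
    ... | false = refl
    ... | true rewrite sym (≡ᵇ-true⇒≡ s t e) | free = refl

IsFirstFree : Occupancy → ℕ → ℕ → Set
IsFirstFree O p s = p ≤ s × O s ≡ false × (∀ t → p ≤ t → t < s → O t ≡ true)

firstFree-or-full : ∀ (O : Occupancy) p M → 1 ≤ p →
  (Σ ℕ λ s → IsFirstFree O p s × s ≤ M) ⊎ (∀ t → p ≤ t → t ≤ M → O t ≡ true)
firstFree-or-full O p zero 1≤p = inj₂ λ t p≤t t≤0 → ⊥-elim (n≮n 0 (≤-trans 1≤p (≤-trans p≤t t≤0)))
firstFree-or-full O p (suc M) 1≤p with firstFree-or-full O p M 1≤p
... | inj₁ (s , first , s≤M) = inj₁ (s , first , m≤n⇒m≤1+n s≤M)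
... | inj₂ full with p ≤? suc M | O (suc M) in e
...   | no p≰1+M | _ = inj₂ λ t p≤t t≤1+M → ⊥-elim (p≰1+M (≤-trans p≤t t≤1+M))
...   | yes p≤1+M | false = inj₁ (suc M , (p≤1+M , e , λ t p≤t t<1+M → full t p≤t (≤-pred t<1+M)) , ≤-refl)
...   | yes _ | true = inj₂ full′
  where
    full′ : ∀ t → p ≤ t → t ≤ suc M → O t ≡ true
    full′ t p≤t t≤1+M with m≤n⇒m<n∨m≡n t≤1+M
    ... | inj₁ t≤M = full t p≤t (≤-pred t≤M)
    ... | inj₂ refl = e

lastFree-upTo : ∀ (O : Occupancy) → O 0 ≡ false → ∀ p → Σ ℕ λ j → j ≤ p × O j ≡ false × (∀ t → j < t → t ≤ p → O t ≡ true)
lastFree-upTo O free₀ zero = 0 , z≤n , free₀ , λ t 0<t t≤0 → ⊥-elim (n≮n 0 (<-≤-trans 0<t t≤0))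
lastFree-upTo O free₀ (suc p) with O (suc p) in e | lastFree-upTo O free₀ p
... | false | _ = suc p , ≤-refl , e , λ t p<t t≤p → ⊥-elim (n≮n t (<-≤-trans (≤-<-trans t≤p p<t) ≤-refl))
... | true | j , j≤p , free , full = j , m≤n⇒m≤1+n j≤p , free , full′
  where
    full′ : ∀ t → j < t → t ≤ suc p → O t ≡ true
    full′ t j<t t≤1+p with m≤n⇒m<n∨m≡n t≤1+p
    ... | inj₁ t≤p = full t j<t (≤-pred t≤p)
    ... | inj₂ refl = e

module CircularParking (m₀ : ℕ) where
  open Rotation m₀

  search : Occupancy → ℕ → ℕ → ℕ → ℕ
  search O p zero d = p
  search O p (suc f) d = if O (rotate d p) then search O p f (suc d) else rotate d p

  -- a car preferring p takes the first free spot among p, p + 1, …, m, 1, …, p − 1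
  circularSpot : Occupancy → ℕ → ℕ
  circularSpot O p = search O p m 0

  circularUnlucky : Occupancy → List ℕ → ℕ
  circularUnlucky O [] = 0
  circularUnlucky O (p ∷ ps) = 𝟙 (O p) + circularUnlucky (occupy O (circularSpot O p)) ps

  search-inRange : ∀ (O : Occupancy) p f d → InRange m p → InRange m (search O p f d)
  search-inRange O p zero d ip = ip
  search-inRange O p (suc f) d ip with O (rotate d p)
  ... | true = search-inRange O p f (suc d) ip
  ... | false = rotate-inRange d p

  circularSpot-inRange : ∀ (O : Occupancy) p → InRange m p → InRange m (circularSpot O p)
  circularSpot-inRange O p = search-inRange O p m 0

  circularSpot-preferred : ∀ (O : Occupancy) p → InRange m p → O p ≡ false → circularSpot O p ≡ p
  circularSpot-preferred O p ip free rewrite rotate-zero p ip | free = refl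

  search-free : ∀ (O : Occupancy) p f d d′ → d ≤ d′ → d′ < d + f → O (rotate d′ p) ≡ false → O (search O p f d) ≡ false
  search-free O p zero d d′ d≤d′ d′<d+0 _ = ⊥-elim (n≮n d (≤-<-trans d≤d′ (subst (d′ <_) (+-identityʳ d) d′<d+0)))
  search-free O p (suc f) d d′ d≤d′ d′<d+f free with O (rotate d p) in e
  ... | false = e
  ... | true with m≤n⇒m<n∨m≡n d≤d′
  ...   | inj₁ d<d′ = search-free O p f (suc d) d′ d<d′ (subst (d′ <_) (+-suc d f) d′<d+f) free
  ...   | inj₂ refl = ⊥-elim (not-¬ e free)

  circularSpot-free : ∀ (O : Occupancy) p v → InRange m p → InRange m v → O v ≡ false → O (circularSpot O p) ≡ false
  circularSpot-free O p v ip iv free with rotate-surjective p v ip iv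
  ... | d , d<m , reaches = search-free O p m 0 d z≤n d<m (trans (cong O reaches) free)

  search-first : ∀ (O : Occupancy) p s → InRange m p → IsFirstFree O p s → s ≤ m →
    ∀ e f d → p + d + e ≡ s → e < f → search O p f d ≡ s
  search-first O p s ip (_ , free , _) s≤m zero (suc f) d p+d+0≡s _
    rewrite +-identityʳ (p + d) | rotate-noWrap d p ip (subst (_≤ m) (sym p+d+0≡s) s≤m) | p+d+0≡s | free = refl
  search-first O p s ip first@(_ , free , occupied) s≤m (suc e) (suc f) d p+d+e≡s (s≤s e<f)
    rewrite rotate-noWrap d p ip (≤-trans (m≤m+n (p + d) (suc e)) (subst (_≤ m) (sym p+d+e≡s) s≤m))
          | occupied (p + d) (m≤m+n p d) (subst (p + d <_) p+d+e≡s (m<m+n (p + d) (s≤s z≤n)))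
    = search-first O p s ip first s≤m e f (suc d) (trans (solve 3 (λ p d e → p :+ (con 1 :+ d) :+ e := p :+ d :+ (con 1 :+ e)) refl p d e) p+d+e≡s) e<f

  circularSpot-first : ∀ (O : Occupancy) p s → InRange m p → IsFirstFree O p s → s ≤ m → circularSpot O p ≡ s
  circularSpot-first O p s ip first@(p≤s , _) s≤m =
    search-first O p s ip first s≤m (s ∸ p) m 0 (trans (cong (_+ (s ∸ p)) (+-identityʳ p)) (m+[n∸m]≡n p≤s))
      (<-≤-trans (∸-monoʳ-< {s} (proj₁ ip) p≤s) (≤-trans (m∸n≤m s 0) s≤m))

  ≡ᵇ-rotate : ∀ r a b → r ≤ m → InRange m a → InRange m b → (rotate r a ≡ᵇ rotate r b) ≡ (a ≡ᵇ b)
  ≡ᵇ-rotate r a b r≤m ia ib with a ≟ b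
  ... | yes a≡b = trans (dec-true (rotate r a ≟ rotate r b) (cong (rotate r) a≡b)) (sym (dec-true (a ≟ b) a≡b))
  ... | no a≢b = trans (dec-false (rotate r a ≟ rotate r b) (a≢b ∘ rotate-injective r a b ia ib r≤m)) (sym (dec-false (a ≟ b) a≢b))

  search-rotate : ∀ r (O O′ : Occupancy) → (∀ v → InRange m v → O (rotate r v) ≡ O′ v) → ∀ p → InRange m p →
    ∀ f d → search O (rotate r p) f d ≡ rotate r (search O′ p f d)
  search-rotate r O O′ O∘rotate p ip zero d = refl
  search-rotate r O O′ O∘rotate p ip (suc f) d rewrite rotate-comm d r p ip | O∘rotate (rotate d p) (rotate-inRange d p) with O′ (rotate d p)
  ... | true = search-rotate r O O′ O∘rotate p ip f (suc d)
  ... | false = refl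

  circularUnlucky-rotate : ∀ r → r ≤ m → (O O′ : Occupancy) → (∀ v → InRange m v → O (rotate r v) ≡ O′ v) →
    ∀ ps → All (InRange m) ps → circularUnlucky O (map (rotate r) ps) ≡ circularUnlucky O′ ps
  circularUnlucky-rotate r r≤m O O′ O∘rotate [] [] = refl
  circularUnlucky-rotate r r≤m O O′ O∘rotate (p ∷ ps) (ip ∷ ips) = cong₂ _+_ (cong 𝟙 (O∘rotate p ip)) (begin
    circularUnlucky (occupy O (circularSpot O (rotate r p))) (map (rotate r) ps)
      ≡⟨ cong (λ z → circularUnlucky (occupy O z) (map (rotate r) ps)) (search-rotate r O O′ O∘rotate p ip m 0) ⟩
    circularUnlucky (occupy O (rotate r s)) (map (rotate r) ps)
      ≡⟨ circularUnlucky-rotate r r≤m (occupy O (rotate r s)) (occupy O′ s) occupied∘rotate ps ips ⟩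
    circularUnlucky (occupy O′ s) ps ∎)
    where
      open ≡-Reasoning
      s = circularSpot O′ p
      occupied∘rotate : ∀ v → InRange m v → occupy O (rotate r s) (rotate r v) ≡ occupy O′ s v
      occupied∘rotate v iv = cong₂ _∨_ (≡ᵇ-rotate r s v r≤m (circularSpot-inRange O′ p ip) iv) (O∘rotate v iv)

  rep-rotate : ∀ r → r ≤ m → ∀ τ → All (InRange m) τ → rep (map (rotate r) τ) ≡ rep τ
  rep-rotate r r≤m [] [] = refl
  rep-rotate r r≤m (a ∷ []) _ = refl
  rep-rotate r r≤m (a ∷ b ∷ τ) (ia ∷ ib ∷ iτ) =
    cong₂ _+_ (cong 𝟙 (≡ᵇ-rotate r a b r≤m ia ib)) (rep-rotate r r≤m (b ∷ τ) (ib ∷ iτ))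

-- Linear parking of prime sequences

occupancy : List ℕ → Occupancy
occupancy occ t = occupied t occ

firstFree-≥ : ∀ N fuel occ q s → firstFree N fuel occ q ≡ just s → q ≤ s
firstFree-≥ N (suc fuel) occ q s found with q ≤ᵇ N | occupied q occ
... | true | true = <⇒≤ (firstFree-≥ N fuel occ (suc q) s found)
... | true | false = ≤-reflexive (just-injective found)

linear-unlucky : ∀ N occ p → p ≤ N →
  (if sameSpot (firstFree N (suc N) occ p) p then 0 else 1) ≡ 𝟙 (occupied p occ)
linear-unlucky N occ p p≤N rewrite dec-true (p ≤? N) p≤N with occupied p occ | firstFree N N occ (suc p) in found
... | false | _ rewrite dec-true (p ≟ p) refl = refl
... | true | nothing = refl
... | true | just s rewrite dec-false (s ≟ p) (>⇒≢ (firstFree-≥ N N occ (suc p) s found)) = refl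

firstFree-first : ∀ N occ p s → IsFirstFree (occupancy occ) p s → s ≤ N →
  ∀ e fuel q → p ≤ q → q + e ≡ s → e < fuel → firstFree N fuel occ q ≡ just s
firstFree-first N occ p s (_ , free , _) s≤N zero (suc fuel) q _ q+0≡s _
  rewrite +-identityʳ q | q+0≡s | dec-true (s ≤? N) s≤N | free = refl
firstFree-first N occ p s first@(_ , _ , full) s≤N (suc e) (suc fuel) q p≤q q+e≡s (s≤s e<fuel)
  rewrite dec-true (q ≤? N) (≤-trans (m≤m+n q (suc e)) (subst (_≤ N) (sym q+e≡s) s≤N))
        | full q p≤q (subst (q <_) q+e≡s (m<m+n q (s≤s z≤n)))
  = firstFree-first N occ p s first s≤N e fuel (suc q) (m≤n⇒m≤1+n p≤q) (trans (sym (+-suc q e)) q+e≡s) e<fuel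

module LinearVersusCircular (m₀ : ℕ) where
  open Rotation m₀
  open CycleLemma m₀ using (PrimeCondition)
  open CircularParking m₀

  n : ℕ
  n = suc m

  -- cars h (latest first) have parked in [1, m] and cars rest are to come; since no car has passed a
  -- free spot j, the taken spots in [1, j] are exactly those of the cars of h preferring at most j
  record Consistent (O : Occupancy) (h rest : List ℕ) : Set where
    field
      origin-free : O 0 ≡ false
      free-counts : ∀ j → O j ≡ false → j ≤ m → count O j ≡ countLe j h
      parked : count O m ≡ length h
      cars : length h + length rest ≡ n
      prime : ∀ j → 1 ≤ j → j < m → suc j ≤ countLe j h + countLe j rest

  full-ahead-impossible : ∀ {O h p rest} → Consistent O h (p ∷ rest) → 1 ≤ length rest → InRange m p →
    (∀ t → p ≤ t → t ≤ m → O t ≡ true) → ⊥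
  full-ahead-impossible {O} {h} {suc p′} {rest} cons 1≤L (_ , p≤m) full with lastFree-upTo O (Consistent.origin-free cons) p′
  ... | j , j≤p′ , free , full-below = impossible
    where
      open Consistent cons
      L = length rest
      p = suc p′
      j<p : j < p
      j<p = s≤s j≤p′
      j≤m : j ≤ m
      j≤m = <⇒≤ (<-≤-trans j<p p≤m)
      occupied-above : ∀ t → j < t → t ≤ m → O t ≡ true
      occupied-above t j<t t≤m with t <? p
      ... | yes t<p = full-below t j<t (≤-pred t<p)
      ... | no t≮p = full t (≮⇒≥ t≮p) t≤m
      counts : countLe j h + L ≡ j
      counts = +-cancelʳ-≡ (m ∸ j) _ _ (begin
        countLe j h + L + (m ∸ j)      ≡⟨ solve 3 (λ c l d → c :+ l :+ d := c :+ d :+ l) refl (countLe j h) L (m ∸ j) ⟩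
        countLe j h + (m ∸ j) + L      ≡⟨ cong (λ z → z + (m ∸ j) + L) (free-counts j free j≤m) ⟨
        count O j + (m ∸ j) + L        ≡⟨ cong (_+ L) (count-occupiedAbove O j m j≤m occupied-above) ⟨
        count O m + L                  ≡⟨ cong (_+ L) parked ⟩
        length h + L                   ≡⟨ suc-injective (trans (sym (+-suc (length h) L)) cars) ⟩
        m                              ≡⟨ m+[n∸m]≡n j≤m ⟨
        j + (m ∸ j)                    ∎)
        where open ≡-Reasoning
      impossible : ⊥
      impossible with j ≟ 0
      ... | yes refl = n≮n 0 (≤-trans 1≤L (≤-reflexive (m+n≡0⇒n≡0 (countLe 0 h) counts)))
      ... | no j≢0 = n≮n j (begin-strict
        j                                      <⟨ prime j (n≢0⇒n>0 j≢0) (<-≤-trans j<p p≤m) ⟩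
        countLe j h + countLe j (p ∷ rest)      ≡⟨ cong (countLe j h +_) (trans (countLe-∷ j p rest) (cong (_+ countLe j rest) (𝟙-≤ᵇ-no j<p))) ⟩
        countLe j h + countLe j rest            ≤⟨ +-monoʳ-≤ (countLe j h) (length-filter (_≤? j) rest) ⟩
        countLe j h + L                         ≡⟨ counts ⟩
        j                                       ∎)
        where open ≤-Reasoning

  free-spot-ahead : ∀ {O h p q rest} → Consistent O h (p ∷ q ∷ rest) → InRange m p → Σ ℕ λ s → IsFirstFree O p s × s ≤ m
  free-spot-ahead {O} {p = p} cons ip with firstFree-or-full O p m (proj₁ ip)
  ... | inj₁ found = found
  ... | inj₂ full = ⊥-elim (full-ahead-impossible cons (s≤s z≤n) ip full)

  consistent-step : ∀ {O h p rest s} → Consistent O h (p ∷ rest) → InRange m p → IsFirstFree O p s → s ≤ m →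
    Consistent (occupy O s) (p ∷ h) rest
  consistent-step {O} {h} {p} {rest} {s} cons (1≤p , _) (p≤s , free-s , full) s≤m = record
    { origin-free = trans (cong (_∨ O 0) (dec-false (s ≟ 0) (≢-sym (<⇒≢ 1≤s)))) origin-free
    ; free-counts = free-counts′
    ; parked = trans (count-occupy O s m free-s 1≤s) (trans (cong₂ _+_ parked (𝟙-≤ᵇ-yes s≤m)) (+-comm (length h) 1))
    ; cars = trans (sym (+-suc (length h) (length rest))) cars
    ; prime = λ j 1≤j j<m → subst (suc j ≤_) (moved j) (prime j 1≤j j<m)
    }
    where
      open Consistent cons
      1≤s : 1 ≤ s
      1≤s = ≤-trans 1≤p p≤s
      same-side : ∀ j → O j ≡ false → 𝟙 (s ≤ᵇ j) ≡ 𝟙 (p ≤ᵇ j)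
      same-side j free-j with p ≤? j
      ... | no p≰j = trans (𝟙-≤ᵇ-no (<-≤-trans (≰⇒> p≰j) p≤s)) (sym (𝟙-≤ᵇ-no (≰⇒> p≰j)))
      ... | yes p≤j with s ≤? j
      ...   | yes s≤j = trans (𝟙-≤ᵇ-yes s≤j) (sym (𝟙-≤ᵇ-yes p≤j))
      ...   | no s≰j = ⊥-elim (not-¬ (full j p≤j (≰⇒> s≰j)) free-j)
      free-counts′ : ∀ j → occupy O s j ≡ false → j ≤ m → count (occupy O s) j ≡ countLe j (p ∷ h)
      free-counts′ j free-j j≤m = begin
        count (occupy O s) j        ≡⟨ count-occupy O s j free-s 1≤s ⟩
        count O j + 𝟙 (s ≤ᵇ j)      ≡⟨ cong₂ _+_ (free-counts j O-free j≤m) (same-side j O-free) ⟩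
        countLe j h + 𝟙 (p ≤ᵇ j)    ≡⟨ +-comm (countLe j h) _ ⟩
        𝟙 (p ≤ᵇ j) + countLe j h    ≡⟨ countLe-∷ j p h ⟨
        countLe j (p ∷ h)           ∎
        where
          open ≡-Reasoning
          ∨-false : ∀ {a b} → (a ∨ b) ≡ false → b ≡ false
          ∨-false {false} {false} _ = refl
          O-free : O j ≡ false
          O-free = ∨-false {s ≡ᵇ j} free-j
      moved : ∀ j → countLe j h + countLe j (p ∷ rest) ≡ countLe j (p ∷ h) + countLe j rest
      moved j = begin
        countLe j h + countLe j (p ∷ rest)          ≡⟨ cong (countLe j h +_) (countLe-∷ j p rest) ⟩
        countLe j h + (𝟙 (p ≤ᵇ j) + countLe j rest)
          ≡⟨ solve 3 (λ c i r → c :+ (i :+ r) := i :+ c :+ r) refl (countLe j h) (𝟙 (p ≤ᵇ j)) (countLe j rest) ⟩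
        𝟙 (p ≤ᵇ j) + countLe j h + countLe j rest    ≡⟨ cong (_+ countLe j rest) (countLe-∷ j p h) ⟨
        countLe j (p ∷ h) + countLe j rest          ∎
        where open ≡-Reasoning

  linear≡circular : ∀ occ h rest → Consistent (occupancy occ) h rest → All (InRange m) rest →
    unlAux n occ rest ≡ circularUnlucky (occupancy occ) rest
  linear≡circular occ h [] _ [] = refl
  linear≡circular occ h (p ∷ []) _ (ip ∷ []) = cong (_+ 0) (linear-unlucky n occ p (m≤n⇒m≤1+n (proj₂ ip)))
  linear≡circular occ h (p ∷ q ∷ rest) cons (ip ∷ ips) with free-spot-ahead cons ip
  ... | s , first@(p≤s , _) , s≤m = cong₂ _+_ (linear-unlucky n occ p (m≤n⇒m≤1+n (proj₂ ip))) (begin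
    unlAux n (occAdd (firstFree n (suc n) occ p) occ) (q ∷ rest)
      ≡⟨ cong (λ spot → unlAux n (occAdd spot occ) (q ∷ rest)) linear-spot ⟩
    unlAux n (s ∷ occ) (q ∷ rest)
      ≡⟨ linear≡circular (s ∷ occ) (p ∷ h) (q ∷ rest) (consistent-step cons ip first s≤m) ips ⟩
    circularUnlucky (occupy (occupancy occ) s) (q ∷ rest)
      ≡⟨ cong (λ spot → circularUnlucky (occupy (occupancy occ) spot) (q ∷ rest)) (circularSpot-first (occupancy occ) p s ip first s≤m) ⟨
    circularUnlucky (occupy (occupancy occ) (circularSpot (occupancy occ) p)) (q ∷ rest) ∎)
    where
      open ≡-Reasoning
      linear-spot : firstFree n (suc n) occ p ≡ just s
      linear-spot = firstFree-first n occ p s first (m≤n⇒m≤1+n s≤m) (s ∸ p) (suc n) p ≤-refl (m+[n∸m]≡n p≤s)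
        (s≤s (≤-trans (m∸n≤m s p) (m≤n⇒m≤1+n s≤m)))

  unl≡circularUnlucky : ∀ ρ → All (InRange m) ρ → length ρ ≡ n → PrimeCondition ρ → unl ρ ≡ circularUnlucky vacant ρ
  unl≡circularUnlucky ρ iv len primeCond = trans (cong (λ N → unlAux N [] ρ) len) (linear≡circular [] [] ρ initial iv)
    where
      initial : Consistent (occupancy []) [] ρ
      initial = record
        { origin-free = refl
        ; free-counts = λ j _ _ → count-none j
        ; parked = count-none m
        ; cars = len
        ; prime = primeCond
        }

-- Weighted sums

module WeightedSums {c ℓ : Level} (R : CommutativeSemiring c ℓ) where
  open CommutativeSemiring R
    renaming ( Carrier to C; _+_ to _⊕_; _*_ to _⊛_; refl to ≈-refl; sym to ≈-sym; trans to ≈-trans; setoid to ≈-setoid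
             ; +-assoc to ⊕-assoc; +-comm to ⊕-comm; +-identityˡ to ⊕-identityˡ; +-identityʳ to ⊕-identityʳ
             ; +-cong to ⊕-cong; +-congˡ to ⊕-congˡ; +-congʳ to ⊕-congʳ
             ; *-comm to ⊛-comm; *-identityʳ to ⊛-identityʳ; *-cong to ⊛-cong; *-congˡ to ⊛-congˡ; *-congʳ to ⊛-congʳ
             ; +-commutativeSemigroup to ⊕-commutativeSemigroup; *-commutativeSemigroup to ⊛-commutativeSemigroup )
  open import Relation.Binary.Reasoning.Setoid ≈-setoid
  open import Algebra.Definitions.RawSemiring rawSemiring using (_^_) renaming (_×_ to _·_)
  open import Algebra.Properties.Semiring.Exp semiring using (^-homo-*)
  open import Algebra.Properties.Monoid.Mult +-monoid using (×-homo-+; ×-homo-1)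
  open import Algebra.Properties.CommutativeSemigroup ⊕-commutativeSemigroup using () renaming (interchange to ⊕-interchange)
  open import Algebra.Properties.CommutativeSemigroup ⊛-commutativeSemigroup using () renaming (interchange to ⊛-interchange)

  sumTo : ℕ → (ℕ → C) → C
  sumTo zero h = 0#
  sumTo (suc N) h = sumTo N h ⊕ h (suc N)

  sumSeqs : ℕ → ℕ → (List ℕ → C) → C
  sumSeqs zero M f = f []
  sumSeqs (suc k) M f = sumTo M (λ a → sumSeqs k M (λ σ → f (a ∷ σ)))

  sumTo-cong : ∀ N {h g : ℕ → C} → (∀ t → InRange N t → h t ≈ g t) → sumTo N h ≈ sumTo N g
  sumTo-cong zero _ = ≈-refl
  sumTo-cong (suc N) h≈g = ⊕-cong (sumTo-cong N λ t (1≤t , t≤N) → h≈g t (1≤t , m≤n⇒m≤1+n t≤N)) (h≈g (suc N) (s≤s z≤n , ≤-refl))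

  sumTo-zero : ∀ N {h : ℕ → C} → (∀ t → InRange N t → h t ≈ 0#) → sumTo N h ≈ 0#
  sumTo-zero N {h} h≈0 = ≈-trans (sumTo-cong N h≈0) (zero-sum N)
    where
      zero-sum : ∀ N → sumTo N (λ _ → 0#) ≈ 0#
      zero-sum zero = ≈-refl
      zero-sum (suc N) = ≈-trans (⊕-identityʳ _) (zero-sum N)

  sumTo-+ : ∀ N (h g : ℕ → C) → sumTo N (λ t → h t ⊕ g t) ≈ sumTo N h ⊕ sumTo N g
  sumTo-+ zero h g = ≈-sym (⊕-identityˡ 0#)
  sumTo-+ (suc N) h g = ≈-trans (⊕-congʳ (sumTo-+ N h g)) (⊕-interchange _ _ _ _)

  sumTo-*ˡ : ∀ N a (h : ℕ → C) → a ⊛ sumTo N h ≈ sumTo N (λ t → a ⊛ h t)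
  sumTo-*ˡ zero a h = zeroʳ a
  sumTo-*ˡ (suc N) a h = ≈-trans (distribˡ a _ _) (⊕-congʳ (sumTo-*ˡ N a h))

  sumTo-*ʳ : ∀ N (h : ℕ → C) a → sumTo N (λ t → h t ⊛ a) ≈ sumTo N h ⊛ a
  sumTo-*ʳ N h a = begin
    sumTo N (λ t → h t ⊛ a)  ≈⟨ sumTo-cong N (λ t _ → ⊛-comm (h t) a) ⟩
    sumTo N (λ t → a ⊛ h t)  ≈⟨ sumTo-*ˡ N a h ⟨
    a ⊛ sumTo N h            ≈⟨ ⊛-comm a _ ⟩
    sumTo N h ⊛ a            ∎

  sumTo-split : ∀ p q (h : ℕ → C) → sumTo (p + q) h ≈ sumTo p h ⊕ sumTo q (λ t → h (p + t))
  sumTo-split p zero h = ≈-trans (reflexive (cong (λ z → sumTo z h) (+-identityʳ p))) (≈-sym (⊕-identityʳ _))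
  sumTo-split p (suc q) h = begin
    sumTo (p + suc q) h                                ≡⟨ cong (λ z → sumTo z h) (+-suc p q) ⟩
    sumTo (p + q) h ⊕ h (suc (p + q))                  ≈⟨ ⊕-congʳ (sumTo-split p q h) ⟩
    (sumTo p h ⊕ sumTo q (λ t → h (p + t))) ⊕ h (suc (p + q))  ≡⟨ cong (λ z → sumTo p h ⊕ sumTo q (λ t → h (p + t)) ⊕ h z) (+-suc p q) ⟨
    (sumTo p h ⊕ sumTo q (λ t → h (p + t))) ⊕ h (p + suc q)    ≈⟨ ⊕-assoc _ _ _ ⟩
    sumTo p h ⊕ sumTo (suc q) (λ t → h (p + t))        ∎

  sumTo-first : ∀ N (h : ℕ → C) → sumTo (suc N) h ≈ h 1 ⊕ sumTo N (λ t → h (suc t))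
  sumTo-first N h = ≈-trans (sumTo-split 1 N h) (⊕-congʳ (⊕-identityˡ (h 1)))

  sumTo-single : ∀ N t₀ (h : ℕ → C) → InRange N t₀ → (∀ t → InRange N t → t ≢ t₀ → h t ≈ 0#) → sumTo N h ≈ h t₀
  sumTo-single zero t₀ h (1≤t₀ , t₀≤0) _ = ⊥-elim (n≮n 0 (≤-trans 1≤t₀ t₀≤0))
  sumTo-single (suc N) t₀ h (1≤t₀ , t₀≤1+N) others with m≤n⇒m<n∨m≡n t₀≤1+N
  ... | inj₂ refl = ≈-trans (⊕-congʳ (sumTo-zero N λ t (1≤t , t≤N) → others t (1≤t , m≤n⇒m≤1+n t≤N) (<⇒≢ (s≤s t≤N)))) (⊕-identityˡ _)
  ... | inj₁ t₀≤N = ≈-trans (⊕-cong (sumTo-single N t₀ h (1≤t₀ , ≤-pred t₀≤N) λ t (1≤t , t≤N) → others t (1≤t , m≤n⇒m≤1+n t≤N))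
                                   (others (suc N) (s≤s z≤n , ≤-refl) (>⇒≢ t₀≤N)))
                          (⊕-identityʳ _)

  sumSeqs-cong : ∀ k M {f g : List ℕ → C} → (∀ σ → length σ ≡ k → All (InRange M) σ → f σ ≈ g σ) →
    sumSeqs k M f ≈ sumSeqs k M g
  sumSeqs-cong zero M f≈g = f≈g [] refl []
  sumSeqs-cong (suc k) M f≈g = sumTo-cong M λ a ia → sumSeqs-cong k M λ σ len iσ → f≈g (a ∷ σ) (cong suc len) (ia ∷ iσ)

  sumSeqs-zero : ∀ k M {f : List ℕ → C} → (∀ σ → length σ ≡ k → All (InRange M) σ → f σ ≈ 0#) → sumSeqs k M f ≈ 0#
  sumSeqs-zero zero M f≈0 = f≈0 [] refl []
  sumSeqs-zero (suc k) M f≈0 = sumTo-zero M λ a ia → sumSeqs-zero k M λ σ len iσ → f≈0 (a ∷ σ) (cong suc len) (ia ∷ iσ)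

  sumSeqs-+ : ∀ k M (f g : List ℕ → C) → sumSeqs k M (λ σ → f σ ⊕ g σ) ≈ sumSeqs k M f ⊕ sumSeqs k M g
  sumSeqs-+ zero M f g = ≈-refl
  sumSeqs-+ (suc k) M f g = ≈-trans (sumTo-cong M (λ a _ → sumSeqs-+ k M _ _)) (sumTo-+ M _ _)

  sumSeqs-*ˡ : ∀ k M a (f : List ℕ → C) → a ⊛ sumSeqs k M f ≈ sumSeqs k M (λ σ → a ⊛ f σ)
  sumSeqs-*ˡ zero M a f = ≈-refl
  sumSeqs-*ˡ (suc k) M a f = ≈-trans (sumTo-*ˡ M a _) (sumTo-cong M (λ b _ → sumSeqs-*ˡ k M a _))

  sumTo-sumSeqs : ∀ N k M (G : ℕ → List ℕ → C) →
    sumTo N (λ r → sumSeqs k M (G r)) ≈ sumSeqs k M (λ σ → sumTo N (λ r → G r σ))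
  sumTo-sumSeqs zero k M G = ≈-sym (sumSeqs-zero k M (λ _ _ _ → ≈-refl))
  sumTo-sumSeqs (suc N) k M G = ≈-trans (⊕-congʳ (sumTo-sumSeqs N k M G)) (≈-sym (sumSeqs-+ k M _ _))

  sumSeqs-restrict : ∀ k M {f : List ℕ → C} →
    (∀ σ → length σ ≡ k → All (InRange (suc M)) σ → ¬ All (InRange M) σ → f σ ≈ 0#) → sumSeqs k (suc M) f ≈ sumSeqs k M f
  sumSeqs-restrict zero M f≈0 = ≈-refl
  sumSeqs-restrict (suc k) M {f} f≈0 = ≈-trans (⊕-cong (sumTo-cong M inner) last) (⊕-identityʳ _)
    where
      inner : ∀ a → InRange M a → sumSeqs k (suc M) (λ σ → f (a ∷ σ)) ≈ sumSeqs k M (λ σ → f (a ∷ σ))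
      inner a (1≤a , a≤M) = sumSeqs-restrict k M λ σ len iσ ¬iσ →
        f≈0 (a ∷ σ) (cong suc len) ((1≤a , m≤n⇒m≤1+n a≤M) ∷ iσ) λ { (_ ∷ iσ′) → ¬iσ iσ′ }
      last : sumSeqs k (suc M) (λ σ → f (suc M ∷ σ)) ≈ 0#
      last = sumSeqs-zero k (suc M) λ σ len iσ →
        f≈0 (suc M ∷ σ) (cong suc len) ((s≤s z≤n , ≤-refl) ∷ iσ) λ { ((_ , 1+M≤M) ∷ _) → n≮n M 1+M≤M }

  listSum : List (List ℕ) → (List ℕ → C) → C
  listSum L f = foldr (λ π acc → f π ⊕ acc) 0# L

  listSum-seqs : ∀ n k (f : List ℕ → C) → listSum (seqs n k) f ≈ sumSeqs k n f
  listSum-seqs n zero f = ⊕-identityʳ _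
  listSum-seqs n (suc k) f = begin
    listSum (concatMap (λ a → map (a ∷_) (seqs n k)) (applyUpTo suc n)) f
      ≈⟨ listSum-concatMap (applyUpTo suc n) ⟩
    foldr (λ a acc → listSum (seqs n k) (λ σ → f (a ∷ σ)) ⊕ acc) 0# (applyUpTo suc n)
      ≈⟨ foldr-applyUpTo n 0 suc (λ a → listSum (seqs n k) (λ σ → f (a ∷ σ))) (λ _ → refl) ⟩
    sumTo n (λ a → listSum (seqs n k) (λ σ → f (a ∷ σ)))
      ≈⟨ sumTo-cong n (λ a _ → listSum-seqs n k _) ⟩
    sumSeqs (suc k) n f ∎
    where
      listSum-++ : ∀ xs ys → listSum (xs ++ ys) f ≈ listSum xs f ⊕ listSum ys f
      listSum-++ [] ys = ≈-sym (⊕-identityˡ _)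
      listSum-++ (x ∷ xs) ys = ≈-trans (⊕-congˡ (listSum-++ xs ys)) (≈-sym (⊕-assoc _ _ _))
      listSum-prefix : ∀ a S → listSum (map (a ∷_) S) f ≈ listSum S (λ σ → f (a ∷ σ))
      listSum-prefix a [] = ≈-refl
      listSum-prefix a (σ ∷ S) = ⊕-congˡ (listSum-prefix a S)
      listSum-concatMap : ∀ V → listSum (concatMap (λ a → map (a ∷_) (seqs n k)) V) f
        ≈ foldr (λ a acc → listSum (seqs n k) (λ σ → f (a ∷ σ)) ⊕ acc) 0# V
      listSum-concatMap [] = ≈-refl
      listSum-concatMap (a ∷ V) = ≈-trans (listSum-++ (map (a ∷_) (seqs n k)) _) (⊕-cong (listSum-prefix a (seqs n k)) (listSum-concatMap V))
      foldr-applyUpTo : ∀ N o (g : ℕ → ℕ) (F : ℕ → C) → (∀ i → g i ≡ o + suc i) →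
        foldr (λ a acc → F a ⊕ acc) 0# (applyUpTo g N) ≈ sumTo N (λ t → F (o + t))
      foldr-applyUpTo zero o g F g≗ = ≈-refl
      foldr-applyUpTo (suc N) o g F g≗ = begin
        F (g 0) ⊕ foldr (λ a acc → F a ⊕ acc) 0# (applyUpTo (λ i → g (suc i)) N)
          ≈⟨ ⊕-cong (reflexive (cong F (g≗ 0))) (foldr-applyUpTo N (suc o) (λ i → g (suc i)) F (λ i → trans (g≗ (suc i)) (+-suc o (suc i)))) ⟩
        F (o + 1) ⊕ sumTo N (λ t → F (suc o + t))
          ≈⟨ ⊕-congˡ (sumTo-cong N (λ t _ → reflexive (cong F (sym (+-suc o t))))) ⟩
        F (o + 1) ⊕ sumTo N (λ t → F (o + suc t))
          ≈⟨ sumTo-first N (λ t → F (o + t)) ⟨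
        sumTo (suc N) (λ t → F (o + t)) ∎

  listSum-filter : ∀ (b : List ℕ → Bool) L (f : List ℕ → C) →
    listSum (filter (λ π → b π Data.Bool.≟ true) L) f ≈ listSum L (λ π → if b π then f π else 0#)
  listSum-filter b [] f = ≈-refl
  listSum-filter b (π ∷ L) f with b π
  ... | true = ⊕-congˡ (listSum-filter b L f)
  ... | false = ≈-trans (listSum-filter b L f) (≈-sym (⊕-identityˡ _))

  module _ (m₀ : ℕ) where
    open Rotation m₀
    open CycleLemma m₀ using (PrimeCondition; primeRotation-exists; primeRotation-unique)
    open Primality m₀ using (n; primeCondition⇔isPrime; prime⇒≤m; isPPF≡isPrime)
    open CircularParking m₀
    open LinearVersusCircular m₀ using (unl≡circularUnlucky)

    sumTo-rotate : ∀ r → r ≤ m → (H : ℕ → C) → sumTo m (λ t → H (rotate r t)) ≈ sumTo m H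
    sumTo-rotate r r≤m H = begin
      sumTo m (λ t → H (rotate r t))
        ≡⟨ cong (λ z → sumTo z (λ t → H (rotate r t))) (sym k+r≡m) ⟩
      sumTo (k + r) (λ t → H (rotate r t))
        ≈⟨ sumTo-split k r _ ⟩
      sumTo k (λ t → H (rotate r t)) ⊕ sumTo r (λ t → H (rotate r (k + t)))
        ≈⟨ ⊕-cong (sumTo-cong k low) (sumTo-cong r high) ⟩
      sumTo k (λ t → H (r + t)) ⊕ sumTo r H
        ≈⟨ ⊕-comm _ _ ⟩
      sumTo r H ⊕ sumTo k (λ t → H (r + t))
        ≈⟨ sumTo-split r k H ⟨
      sumTo (r + k) H
        ≡⟨ cong (λ z → sumTo z H) (trans (+-comm r k) k+r≡m) ⟩
      sumTo m H ∎
      where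
        k = m ∸ r
        k+r≡m : k + r ≡ m
        k+r≡m = m∸n+n≡m r≤m
        low : ∀ t → InRange k t → H (rotate r t) ≈ H (r + t)
        low t (1≤t , t≤k) = reflexive (cong H (rotate-low k+r≡m t (1≤t , ≤-trans t≤k (m∸n≤m m r)) t≤k))
        high : ∀ t → InRange r t → H (rotate r (k + t)) ≈ H t
        high t (1≤t , t≤r) = reflexive (cong H (+-cancelˡ-≡ k _ _ (rotate-high k+r≡m (k + t) ik+t (m<m+n k 1≤t))))
          where
            ik+t : InRange m (k + t)
            ik+t = ≤-trans 1≤t (m≤n+m t k) , subst (k + t ≤_) k+r≡m (+-monoʳ-≤ k t≤r)

    sumSeqs-rotate : ∀ k r → r ≤ m → (g : List ℕ → C) → sumSeqs k m (λ σ → g (map (rotate r) σ)) ≈ sumSeqs k m g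
    sumSeqs-rotate zero r r≤m g = ≈-refl
    sumSeqs-rotate (suc k) r r≤m g = ≈-trans (sumTo-cong m (λ a _ → sumSeqs-rotate k r r≤m (λ σ → g (rotate r a ∷ σ))))
                                             (sumTo-rotate r r≤m (λ a → sumSeqs k m (λ σ → g (a ∷ σ))))

    sumSeqs-by-rotation : ∀ k (F : List ℕ → C) → sumSeqs (suc k) m F ≈ sumTo m (λ r → sumSeqs k m (λ σ → F (map (rotate r) (m ∷ σ))))
    sumSeqs-by-rotation k F = sumTo-cong m λ r ir → ≈-trans
      (≈-sym (sumSeqs-rotate k r (proj₂ ir) (λ σ → F (r ∷ σ))))
      (sumSeqs-cong k m λ σ _ _ → reflexive (cong (λ a → F (a ∷ map (rotate r) σ)) (sym (rotate-top r ir))))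

    module _ (x y : C) where

      -- the factor of x^unl y^rep contributed by a car preferring a right after a car preferring p
      stepWeight : Occupancy → ℕ → ℕ → C
      stepWeight O p a = (x ^ 𝟙 (O a)) ⊛ (y ^ 𝟙 (p ≡ᵇ a))

      -- a car arriving when k spots are taken, one of them the previous car's preference: that spot
      -- gives xy, the other k − 1 taken spots give x and the m − k free spots give 1
      factor : ℕ → C
      factor k = ((x ⊛ y) ⊕ ((k ∸ 1) · x)) ⊕ ((m ∸ k) · 1#)

      sumTo-indicator : ∀ N (h : ℕ → Bool) v → sumTo N (λ t → 𝟙 (h t) · v) ≈ count h N · v
      sumTo-indicator zero h v = ≈-refl
      sumTo-indicator (suc N) h v = ≈-trans (⊕-congʳ (sumTo-indicator N h v)) (≈-sym (×-homo-+ v (count h N) _))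

      stepWeight-split : ∀ O p a → O p ≡ true →
        stepWeight O p a ≈ (𝟙 (p ≡ᵇ a) · (x ⊛ y) ⊕ 𝟙 (O a ∧ not (p ≡ᵇ a)) · x) ⊕ 𝟙 (not (O a)) · 1#
      stepWeight-split O p a occupied-p with O a in e | p ≡ᵇ a in p≡a
      ... | true | true = ≈-trans (⊛-cong (⊛-identityʳ x) (⊛-identityʳ y)) (≈-sym (≈-trans (⊕-identityʳ _) (≈-trans (⊕-identityʳ _) (⊕-identityʳ _))))
      ... | true | false = ≈-trans (⊛-identityʳ _) (≈-trans (⊛-identityʳ x) (≈-sym (≈-trans (⊕-identityʳ _) (≈-trans (⊕-identityˡ _) (⊕-identityʳ _)))))
      ... | false | true = ⊥-elim (not-¬ (subst (λ t → O t ≡ true) (≡ᵇ-true⇒≡ p a p≡a) occupied-p) e)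
      ... | false | false = ≈-trans (⊛-identityʳ _) (≈-sym (≈-trans (⊕-congʳ (⊕-identityˡ 0#)) (≈-trans (⊕-identityˡ _) (⊕-identityʳ _))))

      stepWeight-total : ∀ O p k → O p ≡ true → InRange m p → count O m ≡ k → sumTo m (stepWeight O p) ≈ factor k
      stepWeight-total O p k occupied-p (1≤p , p≤m) count≡k = begin
        sumTo m (stepWeight O p)
          ≈⟨ sumTo-cong m (λ a _ → stepWeight-split O p a occupied-p) ⟩
        sumTo m (λ a → (𝟙 (p ≡ᵇ a) · (x ⊛ y) ⊕ 𝟙 (other a) · x) ⊕ 𝟙 (free a) · 1#)
          ≈⟨ ≈-trans (sumTo-+ m _ _) (⊕-congʳ (sumTo-+ m _ _)) ⟩
        (sumTo m (λ a → 𝟙 (p ≡ᵇ a) · (x ⊛ y)) ⊕ sumTo m (λ a → 𝟙 (other a) · x)) ⊕ sumTo m (λ a → 𝟙 (free a) · 1#)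
          ≈⟨ ⊕-cong (⊕-cong (sumTo-indicator m (p ≡ᵇ_) (x ⊛ y)) (sumTo-indicator m other x)) (sumTo-indicator m free 1#) ⟩
        (count (p ≡ᵇ_) m · (x ⊛ y) ⊕ count other m · x) ⊕ count free m · 1#
          ≈⟨ ⊕-cong (⊕-cong (≈-trans (reflexive (cong (_· (x ⊛ y)) #previous)) (×-homo-1 _)) (reflexive (cong (_· x) #other)))
                    (reflexive (cong (_· 1#) #free)) ⟩
        factor k ∎
        where
          other free : ℕ → Bool
          other a = O a ∧ not (p ≡ᵇ a)
          free a = not (O a)
          #previous : count (p ≡ᵇ_) m ≡ 1
          #previous = trans (count-single p m 1≤p) (𝟙-≤ᵇ-yes p≤m)
          #occupied : count (p ≡ᵇ_) m + count other m ≡ k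
          #occupied = trans (count-pointwise (p ≡ᵇ_) other O m (λ t _ → split t)) count≡k
            where
              split : ∀ t → 𝟙 (p ≡ᵇ t) + 𝟙 (other t) ≡ 𝟙 (O t)
              split t with p ≡ᵇ t in p≡t
              ... | true rewrite sym (≡ᵇ-true⇒≡ p t p≡t) | occupied-p = refl
              ... | false rewrite ∧-identityʳ (O t) = refl
          #other : count other m ≡ k ∸ 1
          #other = trans (sym (m+n∸m≡n 1 (count other m))) (cong (_∸ 1) (trans (cong (_+ count other m) (sym #previous)) #occupied))
          #free : count free m ≡ m ∸ k
          #free = trans (sym (m+n∸n≡m (count free m) k)) (cong (_∸ k) (trans (cong (count free m +_) (sym count≡k))
            (trans (count-pointwise free O (λ _ → true) m (λ t _ → free+occupied (O t))) (count-all m))))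
            where
              free+occupied : ∀ b → 𝟙 (not b) + 𝟙 b ≡ 1
              free+occupied true = refl
              free+occupied false = refl

      circularWeight : Occupancy → ℕ → List ℕ → C
      circularWeight O p σ = (x ^ circularUnlucky O σ) ⊛ (y ^ rep (p ∷ σ))

      circularWeight-∷ : ∀ O p a σ →
        circularWeight O p (a ∷ σ) ≈ stepWeight O p a ⊛ circularWeight (occupy O (circularSpot O a)) a σ
      circularWeight-∷ O p a σ = ≈-trans (⊛-cong (^-homo-* x (𝟙 (O a)) _) (^-homo-* y (𝟙 (p ≡ᵇ a)) (rep (a ∷ σ)))) (⊛-interchange _ _ _ _)

      factors : ℕ → ℕ → C
      factors k zero = 1#
      factors k (suc L) = factor k ⊛ factors (suc k) L

      after-circularPark : ∀ O a → InRange m a → count O m < m →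
        occupy O (circularSpot O a) a ≡ true × count (occupy O (circularSpot O a)) m ≡ suc (count O m)
      after-circularPark O a ia not-full with count-notFull O m not-full
      ... | v , iv , free-v = occupied-a , trans (count-occupy O s m free-s (proj₁ is)) (trans (cong (count O m +_) (𝟙-≤ᵇ-yes (proj₂ is))) (+-comm _ 1))
        where
          s = circularSpot O a
          is : InRange m s
          is = circularSpot-inRange O a ia
          free-s : O s ≡ false
          free-s = circularSpot-free O a v ia iv free-v
          occupied-a : occupy O s a ≡ true
          occupied-a with O a in e
          ... | true = ∨-zeroʳ (s ≡ᵇ a)
          ... | false = cong (_∨ false) (dec-true (s ≟ a) (circularSpot-preferred O a ia e))

      sumSeqs-circularWeight-step : ∀ L k O p → O p ≡ true → InRange m p → count O m ≡ k →
        (∀ a → InRange m a → sumSeqs L m (circularWeight (occupy O (circularSpot O a)) a) ≈ factors (suc k) L) →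
        sumSeqs (suc L) m (circularWeight O p) ≈ factors k (suc L)
      sumSeqs-circularWeight-step L k O p occupied-p ip count≡k later = begin
        sumTo m (λ a → sumSeqs L m (λ σ → circularWeight O p (a ∷ σ)))  ≈⟨ sumTo-cong m per-spot ⟩
        sumTo m (λ a → stepWeight O p a ⊛ factors (suc k) L)            ≈⟨ sumTo-*ʳ m (stepWeight O p) _ ⟩
        sumTo m (stepWeight O p) ⊛ factors (suc k) L                    ≈⟨ ⊛-congʳ (stepWeight-total O p k occupied-p ip count≡k) ⟩
        factors k (suc L)                                               ∎
        where
          per-spot : ∀ a → InRange m a → sumSeqs L m (λ σ → circularWeight O p (a ∷ σ)) ≈ stepWeight O p a ⊛ factors (suc k) L
          per-spot a ia = begin
            sumSeqs L m (λ σ → circularWeight O p (a ∷ σ))       ≈⟨ sumSeqs-cong L m (λ σ _ _ → circularWeight-∷ O p a σ) ⟩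
            sumSeqs L m (λ σ → stepWeight O p a ⊛ circularWeight O′ a σ)  ≈⟨ sumSeqs-*ˡ L m _ _ ⟨
            stepWeight O p a ⊛ sumSeqs L m (circularWeight O′ a)  ≈⟨ ⊛-congˡ (later a ia) ⟩
            stepWeight O p a ⊛ factors (suc k) L                  ∎
            where O′ = occupy O (circularSpot O a)

      -- the bound lets the last of the L cars find the circle full
      sumSeqs-circularWeight : ∀ L k O p → O p ≡ true → InRange m p → count O m ≡ k → k + L ≤ suc m →
        sumSeqs L m (circularWeight O p) ≈ factors k L
      sumSeqs-circularWeight zero k O p _ _ _ _ = ⊛-identityʳ 1#
      sumSeqs-circularWeight (suc zero) k O p occupied-p ip count≡k _ =
        sumSeqs-circularWeight-step 0 k O p occupied-p ip count≡k (λ _ _ → ⊛-identityʳ 1#)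
      sumSeqs-circularWeight (suc (suc L)) k O p occupied-p ip count≡k bound =
        sumSeqs-circularWeight-step (suc L) k O p occupied-p ip count≡k λ a ia →
          let parked = after-circularPark O a ia (subst (_< m) (sym count≡k) k<m) in
          sumSeqs-circularWeight (suc L) (suc k) _ a (proj₁ parked) ia (trans (proj₂ parked) (cong suc count≡k))
            (≤-trans (≤-reflexive (sym (+-suc k (suc L)))) bound)
        where
          k<m : k < m
          k<m = ≤-pred (≤-trans (≤-trans (≤-reflexive (+-comm 2 k)) (+-monoʳ-≤ k (s≤s (s≤s z≤n)))) bound)

      weight : List ℕ → C
      weight π = (x ^ unl π) ⊛ (y ^ rep π)

      primeWeight : List ℕ → C
      primeWeight π = if isPrime π then weight π else 0#

      orbit-sum : ∀ τ → All (InRange m) τ → length τ ≡ n →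
        sumTo m (λ r → primeWeight (map (rotate r) τ)) ≈ (x ^ circularUnlucky vacant τ) ⊛ (y ^ rep τ)
      orbit-sum τ iτ len with primeRotation-exists τ iτ len
      ... | r₀ , ir₀ , primeCond = begin
        sumTo m (λ r → primeWeight (ρ r))   ≈⟨ sumTo-single m r₀ _ ir₀ others ⟩
        primeWeight (ρ r₀)                  ≡⟨ cong (λ b → if b then weight (ρ r₀) else 0#) (to (prime⇔ r₀) primeCond) ⟩
        weight (ρ r₀)                       ≡⟨ cong₂ (λ u v → (x ^ u) ⊛ (y ^ v)) unl≡ (rep-rotate r₀ (proj₂ ir₀) τ iτ) ⟩
        (x ^ circularUnlucky vacant τ) ⊛ (y ^ rep τ) ∎
        where
          ρ : ℕ → List ℕ
          ρ r = map (rotate r) τ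
          inRange : ∀ r → All (InRange m) (ρ r)
          inRange r = map⁺ (universal (rotate-inRange r) τ)
          length-ρ : ∀ r → length (ρ r) ≡ n
          length-ρ r = trans (length-map (rotate r) τ) len
          prime⇔ : ∀ r → PrimeCondition (ρ r) ⇔ isPrime (ρ r) ≡ true
          prime⇔ r = primeCondition⇔isPrime (ρ r) (inRange r) (length-ρ r)
          others : ∀ r → InRange m r → r ≢ r₀ → primeWeight (ρ r) ≈ 0#
          others r ir r≢r₀ with isPrime (ρ r) in isP
          ... | false = ≈-refl
          ... | true = ⊥-elim (r≢r₀ (primeRotation-unique τ iτ len ir ir₀ (from (prime⇔ r) isP) primeCond))
          unl≡ : unl (ρ r₀) ≡ circularUnlucky vacant τ
          unl≡ = trans (unl≡circularUnlucky (ρ r₀) (inRange r₀) (length-ρ r₀) primeCond)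
                       (circularUnlucky-rotate r₀ (proj₂ ir₀) _ _ (λ _ _ → refl) τ iτ)

      afterFirstCar : Occupancy
      afterFirstCar = occupy vacant (circularSpot vacant m)

      afterFirstCar-m : afterFirstCar m ≡ true
      afterFirstCar-m = cong (_∨ false) (dec-true (_ ≟ m) (circularSpot-preferred vacant m (s≤s z≤n , ≤-refl) refl))

      afterFirstCar-count : count afterFirstCar m ≡ 1
      afterFirstCar-count = trans (count-occupy vacant _ m refl (proj₁ spot-inRange))
                              (cong₂ _+_ (count-none m) (𝟙-≤ᵇ-yes (proj₂ spot-inRange)))
        where spot-inRange = circularSpot-inRange vacant m (s≤s z≤n , ≤-refl)

      factors-applyUpTo : ∀ L k (g : ℕ → ℕ) → (∀ i → g i ≡ k + i) →
        foldr (λ i acc → ((x ⊛ y) ⊕ ((i ∸ 1) · x) ⊕ ((n ∸ 1 ∸ i) · 1#)) ⊛ acc) 1# (applyUpTo g L) ≈ factors k L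
      factors-applyUpTo zero k g g≗ = ≈-refl
      factors-applyUpTo (suc L) k g g≗ = ⊛-cong (reflexive (cong factor (trans (g≗ 0) (+-identityʳ k))))
        (factors-applyUpTo L (suc k) (λ i → g (suc i)) (λ i → trans (g≗ (suc i)) (+-suc k i)))

      ppfPoly≈rhsPoly : ppfPoly R n x y ≈ rhsPoly R n x y
      ppfPoly≈rhsPoly = begin
        ppfPoly R n x y
          ≈⟨ listSum-filter isPPF (seqs n n) weight ⟩
        listSum (seqs n n) (λ π → if isPPF π then weight π else 0#)
          ≈⟨ listSum-seqs n n _ ⟩
        sumSeqs n n (λ π → if isPPF π then weight π else 0#)
          ≈⟨ sumSeqs-cong n n (λ π len iπ → reflexive (cong (λ b → if b then weight π else 0#) (isPPF≡isPrime π iπ len))) ⟩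
        sumSeqs n n primeWeight
          ≈⟨ sumSeqs-restrict n m not-prime ⟩
        sumSeqs n m primeWeight
          ≈⟨ sumSeqs-by-rotation m primeWeight ⟩
        sumTo m (λ r → sumSeqs m m (λ σ → primeWeight (map (rotate r) (m ∷ σ))))
          ≈⟨ sumTo-sumSeqs m m m (λ r σ → primeWeight (map (rotate r) (m ∷ σ))) ⟩
        sumSeqs m m (λ σ → sumTo m (λ r → primeWeight (map (rotate r) (m ∷ σ))))
          ≈⟨ sumSeqs-cong m m (λ σ len iσ → orbit-sum (m ∷ σ) ((s≤s z≤n , ≤-refl) ∷ iσ) (cong suc len)) ⟩
        sumSeqs m m (circularWeight afterFirstCar m)
          ≈⟨ sumSeqs-circularWeight m 1 afterFirstCar m afterFirstCar-m (s≤s z≤n , ≤-refl) afterFirstCar-count ≤-refl ⟩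
        factors 1 m
          ≈⟨ factors-applyUpTo m 1 suc (λ _ → refl) ⟨
        rhsPoly R n x y ∎
        where
          not-prime : ∀ π → length π ≡ n → All (InRange n) π → ¬ All (InRange m) π → primeWeight π ≈ 0#
          not-prime π len iπ ¬iπ with isPrime π in isP
          ... | false = ≈-refl
          ... | true = ⊥-elim (¬iπ (zipWith (λ ((1≤v , _) , v≤m) → 1≤v , v≤m) (iπ , prime⇒≤m π len isP)))

theorem5p1 : ∀ {c ℓ : Level} (R : CommutativeSemiring c ℓ) (n : ℕ) → n ≥ 1 →
    (x y : CommutativeSemiring.Carrier R) →
    CommutativeSemiring._≈_ R (ppfPoly R n x y) (rhsPoly R n x y)
theorem5p1 R (suc zero) _ x y = R.trans (R.+-identityʳ _) (R.*-identityʳ R.1#)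
  where module R = CommutativeSemiring R
theorem5p1 R (suc (suc m₀)) _ x y = WeightedSums.ppfPoly≈rhsPoly R m₀ x y
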